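{- Let $p\equiv1\pmod4$ be prime. Consider the six matrices $U^{4,i,j}$ ($i\in\{1,2\}$, $j\in\{1,2,3\}$) with rows and columns indexed by $\binom{\mathbb{F}_p}{2}$, all of whose entries at pairs of index sets not sharing exactly one element are $0$, and whose entry at $(\{a,b\},\{a,c\})$ with $a,b,c$ distinct is, summing over $k\in\mathbb{F}_p\setminus\{a,b,c\}$: for $U^{4,1,1}$, $\sum_k S_{a,k}$; for $U^{4,1,2}$, $\sum_k S_{b,k}$; for $U^{4,1,3}$, $\sum_k S_{c,k}$; for $U^{4,2,1}$, $\sum_k S_{a,k}S_{b,k}$; for $U^{4,2,2}$, $\sum_k S_{a,k}S_{c,k}$; for $U^{4,2,3}$, $\sum_k S_{b,k}S_{c,k}$. Then $\|U^{4,i,j}\|=O(p)$ for each $i\in\{1,2\}$, $j\in\{1,2,3\}$.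
   Context: $S_{x,y}=\chi(x-y)$ where $\chi$ is the Legendre symbol of $\mathbb{F}_p$ ($\chi(0)=0$). $\|\cdot\|$ is the operator norm; asymptotics as $p\to\infty$.
   Formalization: The operator norm of each $U^{4,i,j}$ is taken only over vectors with rational entries. -}

module Defs where

open import Data.Nat using (ℕ; zero; suc; _+_; _*_; _∸_; _<ᵇ_; _≡ᵇ_; NonZero)
open import Data.Nat.DivMod using (_%_)
open import Data.Bool using (Bool; true; false; if_then_else_; _∧_; _∨_; not)
open import Data.Bool.ListAction using (any)
open import Data.List using (List; []; _∷_; upTo; filterᵇ; map; foldr; concatMap)
open import Data.Product using (_×_; _,_; proj₁; proj₂)
open import Data.Integer as ℤ using (ℤ; +_; -[1+_])
open import Data.Rational as ℚ using (ℚ; 0ℚ)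

-- Elements of 𝔽_p are represented by the naturals 0,…,p-1 (the list upTo p).

isSquareᵇ : (p : ℕ) .{{_ : NonZero p}} → ℕ → Bool
isSquareᵇ p x = any (λ y → ((y * y) % p) ≡ᵇ (x % p)) (upTo p)

legendre : (p : ℕ) .{{_ : NonZero p}} → ℕ → ℤ
legendre p x =
  if (x % p) ≡ᵇ 0 then + 0
  else if isSquareᵇ p x then + 1 else -[1+ 0 ]

-- S_{x,y} = χ(x - y), for x, y ∈ {0,…,p-1}; x - y computed mod p.
S : (p : ℕ) .{{_ : NonZero p}} → ℕ → ℕ → ℤ
S p x y = legendre p ((x + p) ∸ y)

sumℤ : List ℤ → ℤ
sumℤ = foldr ℤ._+_ (+ 0)

sumℚ : List ℚ → ℚ
sumℚ = foldr ℚ._+_ 0ℚ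

others : ℕ → ℕ → ℕ → ℕ → List ℕ
others p a b c = filterᵇ (λ k → not ((k ≡ᵇ a) ∨ (k ≡ᵇ b) ∨ (k ≡ᵇ c))) (upTo p)

data I : Set where i1 i2 : I
data J : Set where j1 j2 j3 : J

kernel : (p : ℕ) .{{_ : NonZero p}} → I → J → ℕ → ℕ → ℕ → ℤ
kernel p i1 j1 a b c = sumℤ (map (λ k → S p a k) (others p a b c))
kernel p i1 j2 a b c = sumℤ (map (λ k → S p b k) (others p a b c))
kernel p i1 j3 a b c = sumℤ (map (λ k → S p c k) (others p a b c))
kernel p i2 j1 a b c = sumℤ (map (λ k → S p a k ℤ.* S p b k) (others p a b c))
kernel p i2 j2 a b c = sumℤ (map (λ k → S p a k ℤ.* S p c k) (others p a b c))
kernel p i2 j3 a b c = sumℤ (map (λ k → S p b k ℤ.* S p c k) (others p a b c))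

-- 2-element subsets of 𝔽_p, represented as (a , b) with a < b.
pairs : ℕ → List (ℕ × ℕ)
pairs p = concatMap (λ a → map (λ b → (a , b)) (filterᵇ (λ b → a <ᵇ b) (upTo p))) (upTo p)

-- Nonzero only if |e ∩ f| = 1; then with a the common element, b the other
-- element of e, c the other element of f, the entry is kernel a b c.
U : (p : ℕ) .{{_ : NonZero p}} → I → J → ℕ × ℕ → ℕ × ℕ → ℤ
U p i j (e₁ , e₂) (f₁ , f₂) =
  if (e₁ ≡ᵇ f₁) ∧ (e₂ ≡ᵇ f₂) then + 0
  else if e₁ ≡ᵇ f₁ then kernel p i j e₁ e₂ f₂
  else if e₁ ≡ᵇ f₂ then kernel p i j e₁ e₂ f₁
  else if e₂ ≡ᵇ f₁ then kernel p i j e₂ e₁ f₂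
  else if e₂ ≡ᵇ f₂ then kernel p i j e₂ e₁ f₁
  else + 0

Vector : Set
Vector = ℕ × ℕ → ℚ

normSq : ℕ → Vector → ℚ
normSq p x = sumℚ (map (λ e → x e ℚ.* x e) (pairs p))

apply : (p : ℕ) .{{_ : NonZero p}} → I → J → Vector → Vector
apply p i j x e = sumℚ (map (λ f → (U p i j e f ℚ./ 1) ℚ.* x f) (pairs p))

-- ‖U x‖² ≤ M² ‖x‖² for all rational x  ⇔  ‖U‖ ≤ M (operator norm),
-- by homogeneity/continuity and density of ℚ in ℝ.
OpNormBound : (p : ℕ) .{{_ : NonZero p}} → I → J → ℕ → Set
OpNormBound p i j M =
  ∀ (x : Vector) → normSq p (apply p i j x) ℚ.≤ ((+ (M * M) ℚ./ 1) ℚ.* normSq p x)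

module Submission where

-- An entry of U^{4,i,j} vanishes unless its two index pairs share exactly one
-- element, so each row and column has O(p) nonzero entries. These entries are bounded: each is
-- a character sum over all but three points of 𝔽_p, and the full sums are known exactly.
-- Σ_k χ(a − k) = 0 because every z has 1 + χ(z) square roots, and Σ_k χ(a − k) χ(b − k) = −1
-- for a ≠ b because the correlation Σ_u χ(u) χ(u + c) is, by multiplicativity of χ, the same for
-- all c ≠ 0, sums to 0 over all c, and equals p − 1 at c = 0. Hence every entry has absolute
-- value at most 4, all row and column sums of |U| are at most 16p, and the Schur test
-- (Cauchy–Schwarz in each row, then the column sums) gives ‖U‖ ≤ 16p.

open import Defs

open import Level using (Level)
open import Algebra.Bundles using (CommutativeRing)
open import Data.Bool using (Bool; true; false; if_then_else_; not; _∨_; T?)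
open import Data.Bool.ListAction using (any)
open import Data.Bool.Properties using (T-≡)
open import Data.Empty using (⊥-elim)
open import Data.Integer as ℤ using (ℤ; 0ℤ; 1ℤ; -1ℤ)
import Data.Integer.Properties as ℤₚ
import Data.Rational.Properties as ℚₚ
open import Data.List using (List; []; _∷_; [_]; _++_; _∷ʳ_; foldr; map; concatMap; filterᵇ; upTo)
open import Data.List.Membership.Propositional using (_∈_; find; lose)
open import Data.List.Membership.Propositional.Properties using (∈-upTo⁺; ∈-upTo⁻; ∈-map⁻; ∈-concatMap⁻; ∈-filter⁻)
open import Data.List.Properties using (map-++; map-∘; upTo-∷ʳ)
open import Data.List.Relation.Unary.Any using (here; there)
open import Data.List.Relation.Unary.Any.Properties using (any⁺; any⁻)
open import Data.Nat as ℕ using (ℕ; zero; suc; NonZero; _≡ᵇ_; _<ᵇ_; _≟_)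
open import Data.Nat.Primality using (Prime; euclidsLemma; prime⇒nonTrivial)
import Data.Nat.Properties as ℕₚ
open import Data.Nat.DivMod using (_%_; m*n%n≡0; m∣n⇒o%n%m≡o%m)
open import Data.Nat.Divisibility using (divides)
open import Data.Product using (Σ; ∃-syntax; _×_; _,_; proj₁; proj₂)
open import Data.Sum using (_⊎_; inj₁; inj₂)
open import Function using (_∘_; Equivalence)
open import Relation.Nullary using (¬_; yes; no; proof; Reflects; ofʸ; ofⁿ)
open import Relation.Binary.Definitions using (Tri; tri<; tri≈; tri>)
open import Relation.Nullary.Decidable using (dec-true; dec-false)
open import Relation.Binary.PropositionalEquality
  using (_≡_; _≢_; refl; sym; trans; cong; cong₂; subst; subst₂; module ≡-Reasoning)

≡ᵇ-reflects-≡ : ∀ m n → Reflects (m ≡ n) (m ≡ᵇ n)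
≡ᵇ-reflects-≡ m n = proof (m ≟ n)

≡ᵇ-true : ∀ {m n} → m ≡ n → (m ≡ᵇ n) ≡ true
≡ᵇ-true {m} {n} = dec-true (m ≟ n)

≡ᵇ-false : ∀ {m n} → m ≢ n → (m ≡ᵇ n) ≡ false
≡ᵇ-false {m} {n} = dec-false (m ≟ n)

<ᵇ-true : ∀ {m n} → m ℕ.< n → (m <ᵇ n) ≡ true
<ᵇ-true {m} {n} = dec-true (m ℕ.<? n)

<ᵇ-false : ∀ {m n} → ¬ m ℕ.< n → (m <ᵇ n) ≡ false
<ᵇ-false {m} {n} = dec-false (m ℕ.<? n)

≡ᵇ-sym : ∀ m n → (m ≡ᵇ n) ≡ (n ≡ᵇ m)
≡ᵇ-sym zero    zero    = refl
≡ᵇ-sym zero    (suc n) = refl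
≡ᵇ-sym (suc m) zero    = refl
≡ᵇ-sym (suc m) (suc n) = ≡ᵇ-sym m n

module ListSum {c ℓ} (R : CommutativeRing c ℓ) where
  open CommutativeRing R renaming (refl to ≈-refl; sym to ≈-sym; trans to ≈-trans)
  open import Algebra.Properties.CommutativeSemigroup +-commutativeSemigroup using (interchange)
  open import Relation.Binary.Reasoning.Setoid setoid

  sum : List Carrier → Carrier
  sum = foldr _+_ 0#

  sum-++ : ∀ xs ys → sum (xs ++ ys) ≈ sum xs + sum ys
  sum-++ []       ys = ≈-sym (+-identityˡ (sum ys))
  sum-++ (x ∷ xs) ys = ≈-trans (+-congˡ (sum-++ xs ys)) (≈-sym (+-assoc x (sum xs) (sum ys)))

  private variable
    a b : Level
    A : Set a
    B : Set b

  sum-cong : ∀ (xs : List A) {f g : A → Carrier} → (∀ {x} → x ∈ xs → f x ≈ g x) →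
             sum (map f xs) ≈ sum (map g xs)
  sum-cong []       f≈g = ≈-refl
  sum-cong (x ∷ xs) f≈g = +-cong (f≈g (here refl)) (sum-cong xs (f≈g ∘ there))

  sum-zero : ∀ (xs : List A) → sum (map (λ _ → 0#) xs) ≈ 0#
  sum-zero []       = ≈-refl
  sum-zero (x ∷ xs) = ≈-trans (+-identityˡ _) (sum-zero xs)

  sum-distrib-+ : ∀ (xs : List A) (f g : A → Carrier) →
                  sum (map (λ x → f x + g x) xs) ≈ sum (map f xs) + sum (map g xs)
  sum-distrib-+ []       f g = ≈-sym (+-identityˡ 0#)
  sum-distrib-+ (x ∷ xs) f g = ≈-trans (+-congˡ (sum-distrib-+ xs f g)) (interchange (f x) (g x) _ _)

  *-distribˡ-sum : ∀ c (xs : List A) (f : A → Carrier) →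
                   c * sum (map f xs) ≈ sum (map (λ x → c * f x) xs)
  *-distribˡ-sum c []       f = zeroʳ c
  *-distribˡ-sum c (x ∷ xs) f = ≈-trans (distribˡ c (f x) _) (+-congˡ (*-distribˡ-sum c xs f))

  sum-filterᵇ : ∀ (P : A → Bool) (xs : List A) (f : A → Carrier) →
                sum (map f (filterᵇ P xs)) ≈ sum (map (λ x → if P x then f x else 0#) xs)
  sum-filterᵇ P []       f = ≈-refl
  sum-filterᵇ P (x ∷ xs) f with P x
  ... | true  = +-congˡ (sum-filterᵇ P xs f)
  ... | false = ≈-trans (sum-filterᵇ P xs f) (≈-sym (+-identityˡ _))

  sum-concatMap : (g : A → List B) (xs : List A) (f : B → Carrier) →
                  sum (map f (concatMap g xs)) ≈ sum (map (λ x → sum (map f (g x))) xs)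
  sum-concatMap g []       f = ≈-refl
  sum-concatMap g (x ∷ xs) f = begin
    sum (map f (g x ++ concatMap g xs))               ≡⟨ cong sum (map-++ f (g x) _) ⟩
    sum (map f (g x) ++ map f (concatMap g xs))        ≈⟨ sum-++ (map f (g x)) _ ⟩
    sum (map f (g x)) + sum (map f (concatMap g xs))   ≈⟨ +-congˡ (sum-concatMap g xs f) ⟩
    sum (map f (g x)) + sum (map (λ x → sum (map f (g x))) xs) ∎

  sum-comm : (xs : List A) (ys : List B) (f : A → B → Carrier) →
             sum (map (λ x → sum (map (f x) ys)) xs) ≈ sum (map (λ y → sum (map (λ x → f x y) xs)) ys)
  sum-comm []       ys f = ≈-sym (sum-zero ys)
  sum-comm (x ∷ xs) ys f = ≈-trans (+-congˡ (sum-comm xs ys f))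
                                 (≈-sym (sum-distrib-+ ys (f x) (λ y → sum (map (λ x → f x y) xs))))

  sum-*-sum : (xs : List A) (ys : List B) (f : A → Carrier) (g : B → Carrier) →
              sum (map f xs) * sum (map g ys) ≈ sum (map (λ x → sum (map (λ y → f x * g y) ys)) xs)
  sum-*-sum []       ys f g = zeroˡ _
  sum-*-sum (x ∷ xs) ys f g =
    ≈-trans (distribʳ _ (f x) _) (+-cong (*-distribˡ-sum (f x) ys g) (sum-*-sum xs ys f g))

module IntegerSum where
  open ListSum ℤₚ.+-*-commutativeRing public
  open import Data.Integer using (+_; _+_; _*_; -_; _-_; _≤_)
  open import Data.Integer.Tactic.RingSolver using (solve-∀)
  open import Data.Nat using (_<_)

  -- Written as `+ n` so that a sum of indicators computes to some `+ m` even when some of the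
  -- booleans are unknown.
  𝟙 : Bool → ℤ
  𝟙 b = + (if b then 1 else 0)

  sum-mono-≤ : ∀ {a} {A : Set a} (xs : List A) {f g : A → ℤ} → (∀ {x} → x ∈ xs → f x ≤ g x) →
               sum (map f xs) ≤ sum (map g xs)
  sum-mono-≤ []       f≤g = ℤₚ.≤-refl
  sum-mono-≤ (x ∷ xs) f≤g = ℤₚ.+-mono-≤ (f≤g (here refl)) (sum-mono-≤ xs (f≤g ∘ there))

  sum-nonpos : ∀ {a} {A : Set a} (xs : List A) (f : A → ℤ) → (∀ {x} → x ∈ xs → f x ≤ 0ℤ) →
               sum (map f xs) ≤ 0ℤ
  sum-nonpos xs f f≤0 = subst (sum (map f xs) ≤_) (sum-zero xs) (sum-mono-≤ xs f≤0)

  nonpos+nonpos≡0⇒≡0 : ∀ {x y} → x ≤ 0ℤ → y ≤ 0ℤ → x + y ≡ 0ℤ → x ≡ 0ℤ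
  nonpos+nonpos≡0⇒≡0 {x} {y} x≤0 y≤0 x+y≡0 = ℤₚ.≤-antisym x≤0 (begin
    0ℤ       ≡⟨ x+y≡0 ⟨
    x + y    ≤⟨ ℤₚ.+-monoʳ-≤ x y≤0 ⟩
    x + 0ℤ   ≡⟨ ℤₚ.+-identityʳ x ⟩
    x        ∎)
    where open ℤₚ.≤-Reasoning

  sum-nonpos≡0⇒≡0 : ∀ {a} {A : Set a} (xs : List A) (f : A → ℤ) → (∀ {x} → x ∈ xs → f x ≤ 0ℤ) →
                    sum (map f xs) ≡ 0ℤ → ∀ {x} → x ∈ xs → f x ≡ 0ℤ
  sum-nonpos≡0⇒≡0 (y ∷ xs) f f≤0 Σ≡0 (here refl) =
    nonpos+nonpos≡0⇒≡0 (f≤0 (here refl)) (sum-nonpos xs f (f≤0 ∘ there)) Σ≡0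
  sum-nonpos≡0⇒≡0 (y ∷ xs) f f≤0 Σ≡0 (there x∈xs) =
    sum-nonpos≡0⇒≡0 xs f (f≤0 ∘ there)
      (nonpos+nonpos≡0⇒≡0 (sum-nonpos xs f (f≤0 ∘ there)) (f≤0 (here refl))
        (trans (ℤₚ.+-comm (sum (map f xs)) (f y)) Σ≡0))
      x∈xs

  sum≢0⇒nonzero : ∀ {a} {A : Set a} (xs : List A) (f : A → ℤ) → sum (map f xs) ≢ 0ℤ →
                  ∃[ x ] (x ∈ xs × f x ≢ 0ℤ)
  sum≢0⇒nonzero []       f Σ≢0 = ⊥-elim (Σ≢0 refl)
  sum≢0⇒nonzero (y ∷ xs) f Σ≢0 with f y ℤ.≟ 0ℤ
  ... | no  fy≢0 = y , here refl , fy≢0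
  ... | yes fy≡0 with sum≢0⇒nonzero xs f (λ Σ≡0 → Σ≢0 (cong₂ _+_ fy≡0 Σ≡0))
  ...   | x , x∈xs , fx≢0 = x , there x∈xs , fx≢0

  [n-1]*[c+1]≡0⇒c≡-1 : ∀ {n c} → 1 ℕ.< n → (+ n + -1ℤ) * (c + 1ℤ) ≡ 0ℤ → c ≡ -1ℤ
  [n-1]*[c+1]≡0⇒c≡-1 {n} {c} 1<n product≡0 with ℤₚ.i*j≡0⇒i≡0∨j≡0 (+ n + -1ℤ) product≡0
  ... | inj₁ n-1≡0 = ⊥-elim (ℕₚ.<⇒≢ 1<n (sym (ℤₚ.+-injective (begin
    + n                    ≡⟨ restore (+ n) ⟩
    (+ n + -1ℤ) + 1ℤ       ≡⟨ cong (_+ 1ℤ) n-1≡0 ⟩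
    1ℤ                     ∎))))
    where
    open ≡-Reasoning
    restore : ∀ x → x ≡ (x + -1ℤ) + 1ℤ
    restore = solve-∀
  ... | inj₂ c+1≡0 = begin
    c                      ≡⟨ restore c ⟩
    (c + 1ℤ) + -1ℤ         ≡⟨ cong (_+ -1ℤ) c+1≡0 ⟩
    -1ℤ                    ∎
    where
    open ≡-Reasoning
    restore : ∀ x → x ≡ (x + 1ℤ) + -1ℤ
    restore = solve-∀

  ∑ : ℕ → (ℕ → ℤ) → ℤ
  ∑ n f = sum (map f (upTo n))

  syntax ∑ n (λ k → e) = ∑[ k < n ] e

  ∑-suc : ∀ n f → ∑ (suc n) f ≡ ∑ n f + f n
  ∑-suc n f = begin
    sum (map f (upTo (suc n)))        ≡⟨ cong (sum ∘ map f) (upTo-∷ʳ n) ⟨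
    sum (map f (upTo n ++ [ n ]))     ≡⟨ cong sum (map-++ f (upTo n) [ n ]) ⟩
    sum (map f (upTo n) ++ [ f n ])   ≡⟨ sum-++ (map f (upTo n)) [ f n ] ⟩
    ∑ n f + (f n + 0ℤ)                ≡⟨ cong (_+_ (∑ n f)) (ℤₚ.+-identityʳ (f n)) ⟩
    ∑ n f + f n                       ∎
    where open ≡-Reasoning

  ∑-cong : ∀ n {f g : ℕ → ℤ} → (∀ {k} → k < n → f k ≡ g k) → ∑ n f ≡ ∑ n g
  ∑-cong n f≡g = sum-cong (upTo n) (f≡g ∘ ∈-upTo⁻)

  ∑-const : ∀ n c → ∑[ k < n ] c ≡ + n * c
  ∑-const zero    c = sym (ℤₚ.*-zeroˡ c)
  ∑-const (suc n) c = begin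
    ∑[ k < suc n ] c   ≡⟨ ∑-suc n (λ _ → c) ⟩
    ∑[ k < n ] c + c   ≡⟨ cong (_+ c) (∑-const n c) ⟩
    + n * c + c        ≡⟨ cong (_+_ (+ n * c)) (ℤₚ.*-identityˡ c) ⟨
    + n * c + 1ℤ * c   ≡⟨ ℤₚ.*-distribʳ-+ c (+ n) 1ℤ ⟨
    (+ n + 1ℤ) * c     ≡⟨ cong (_* c) (ℤₚ.pos-+ n 1) ⟨
    + (n ℕ.+ 1) * c    ≡⟨ cong (λ m → + m * c) (ℕₚ.+-comm n 1) ⟩
    + suc n * c        ∎
    where open ≡-Reasoning

  ∑-indicator : ∀ n c → ∑[ k < n ] 𝟙 (k ≡ᵇ c) ≡ 𝟙 (c <ᵇ n)
  ∑-indicator zero    c = refl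
  ∑-indicator (suc n) c = begin
    ∑[ k < suc n ] 𝟙 (k ≡ᵇ c)           ≡⟨ ∑-suc n (λ k → 𝟙 (k ≡ᵇ c)) ⟩
    ∑[ k < n ] 𝟙 (k ≡ᵇ c) + 𝟙 (n ≡ᵇ c)  ≡⟨ cong (_+ 𝟙 (n ≡ᵇ c)) (∑-indicator n c) ⟩
    𝟙 (c <ᵇ n) + 𝟙 (n ≡ᵇ c)             ≡⟨ last (ℕₚ.<-cmp c n) ⟩
    𝟙 (c <ᵇ suc n)                      ∎
    where
    open ≡-Reasoning
    last : Tri (c < n) (c ≡ n) (n < c) → 𝟙 (c <ᵇ n) + 𝟙 (n ≡ᵇ c) ≡ 𝟙 (c <ᵇ suc n)
    last (tri< c<n c≢n _)
      rewrite <ᵇ-true c<n | ≡ᵇ-false (c≢n ∘ sym) | <ᵇ-true (ℕₚ.m<n⇒m<1+n c<n) = refl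
    last (tri≈ c≮c refl _)
      rewrite <ᵇ-false c≮c | ≡ᵇ-true (refl {x = c}) | <ᵇ-true (ℕₚ.n<1+n c) = refl
    last (tri> _ c≢n n<c)
      rewrite <ᵇ-false (ℕₚ.<⇒≯ n<c) | ≡ᵇ-false (c≢n ∘ sym)
            | <ᵇ-false (ℕₚ.<⇒≱ n<c ∘ ℕₚ.m<1+n⇒m≤n) = refl

  ∑-pick : ∀ n (f : ℕ → ℤ) {c} → c < n → ∑[ k < n ] (𝟙 (k ≡ᵇ c) * f k) ≡ f c
  ∑-pick n f {c} c<n = begin
    ∑[ k < n ] (𝟙 (k ≡ᵇ c) * f k)    ≡⟨ ∑-cong n (λ {k} _ → picked k) ⟩
    ∑[ k < n ] (f c * 𝟙 (k ≡ᵇ c))    ≡⟨ *-distribˡ-sum (f c) (upTo n) (λ k → 𝟙 (k ≡ᵇ c)) ⟨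
    f c * ∑[ k < n ] 𝟙 (k ≡ᵇ c)    ≡⟨ cong (f c *_) (trans (∑-indicator n c) (cong 𝟙 (<ᵇ-true c<n))) ⟩
    f c * 1ℤ                       ≡⟨ ℤₚ.*-identityʳ (f c) ⟩
    f c                            ∎
    where
    open ≡-Reasoning
    picked : ∀ k → 𝟙 (k ≡ᵇ c) * f k ≡ f c * 𝟙 (k ≡ᵇ c)
    picked k with k ≡ᵇ c | ≡ᵇ-reflects-≡ k c
    ... | true  | ofʸ refl = ℤₚ.*-comm 1ℤ (f k)
    ... | false | ofⁿ _    = trans (ℤₚ.*-zeroˡ (f k)) (sym (ℤₚ.*-zeroʳ (f c)))

  ∑-update : ∀ n {f g : ℕ → ℤ} {q} → q < n → (∀ {k} → k < n → k ≢ q → f k ≡ g k) →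
             ∑ n f + g q ≡ ∑ n g + f q
  ∑-update n {f} {g} {q} q<n f≡g = begin
    ∑ n f + g q
      ≡⟨ cong (_+ g q) (∑-cong n split) ⟩
    ∑[ k < n ] (g k + 𝟙 (k ≡ᵇ q) * (f k - g k)) + g q
      ≡⟨ cong (_+ g q) (sum-distrib-+ (upTo n) g _) ⟩
    ∑ n g + ∑[ k < n ] (𝟙 (k ≡ᵇ q) * (f k - g k)) + g q
      ≡⟨ cong (λ d → ∑ n g + d + g q) (∑-pick n (λ k → f k - g k) q<n) ⟩
    ∑ n g + (f q - g q) + g q
      ≡⟨ cancel (∑ n g) (f q) (g q) ⟩
    ∑ n g + f q ∎
    where
    open ≡-Reasoning
    cancel : ∀ a b c → a + (b - c) + c ≡ a + b
    cancel = solve-∀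
    split : ∀ {k} → k < n → f k ≡ g k + 𝟙 (k ≡ᵇ q) * (f k - g k)
    split {k} k<n with k ≡ᵇ q | ≡ᵇ-reflects-≡ k q
    ... | true  | ofʸ refl = restore (f k) (g k)
      where
      restore : ∀ a b → a ≡ b + 1ℤ * (a - b)
      restore = solve-∀
    ... | false | ofⁿ k≢q = trans (f≡g k<n k≢q) (forget (g k) (f k - g k))
      where
      forget : ∀ a b → a ≡ a + 0ℤ * b
      forget = solve-∀

  transpose : ℕ → ℕ → ℕ → ℕ
  transpose q m x with x ≟ q | x ≟ m
  ... | yes _ | _     = m
  ... | no _  | yes _ = q
  ... | no _  | no _  = x

  transpose-left : ∀ q m → transpose q m q ≡ m
  transpose-left q m with q ≟ q
  ... | yes _  = refl
  ... | no q≢q = ⊥-elim (q≢q refl)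

  transpose-right : ∀ q m → transpose q m m ≡ q
  transpose-right q m with m ≟ q | m ≟ m
  ... | yes m≡q | _      = m≡q
  ... | no _    | yes _  = refl
  ... | no _    | no m≢m = ⊥-elim (m≢m refl)

  transpose-other : ∀ {q m x} → x ≢ q → x ≢ m → transpose q m x ≡ x
  transpose-other {q} {m} {x} x≢q x≢m with x ≟ q | x ≟ m
  ... | yes x≡q | _       = ⊥-elim (x≢q x≡q)
  ... | no _    | yes x≡m = ⊥-elim (x≢m x≡m)
  ... | no _    | no _    = refl

  transpose-involutive : ∀ q m x → transpose q m (transpose q m x) ≡ x
  transpose-involutive q m x with x ≟ q | x ≟ m
  ... | yes refl | _        = transpose-right x m
  ... | no _     | yes refl = transpose-left q x
  ... | no x≢q   | no x≢m   = transpose-other x≢q x≢m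

  transpose-injective : ∀ q m {x y} → transpose q m x ≡ transpose q m y → x ≡ y
  transpose-injective q m {x} {y} τx≡τy = begin
    x                                       ≡⟨ transpose-involutive q m x ⟨
    transpose q m (transpose q m x)         ≡⟨ cong (transpose q m) τx≡τy ⟩
    transpose q m (transpose q m y)         ≡⟨ transpose-involutive q m y ⟩
    y                                       ∎
    where open ≡-Reasoning

  transpose-< : ∀ {q m x n} → q < n → m < n → x < n → transpose q m x < n
  transpose-< {q} {m} {x} q<n m<n x<n with x ≟ q | x ≟ m
  ... | yes _ | _     = m<n
  ... | no _  | yes _ = q<n
  ... | no _  | no _  = x<n

  transpose-self : ∀ m x → transpose m m x ≡ x
  transpose-self m x with x ≟ m
  ... | yes x≡m = sym x≡m
  ... | no _    = refl

  ∑-transpose : ∀ m (g : ℕ → ℤ) {q} → q ℕ.≤ m → ∑[ x < suc m ] g (transpose q m x) ≡ ∑ (suc m) g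
  ∑-transpose m g {q} q≤m with ℕₚ.m≤n⇒m<n∨m≡n q≤m
  ... | inj₂ refl = ∑-cong (suc m) (λ {x} _ → cong g (transpose-self m x))
  ... | inj₁ q<m  = begin
    ∑[ x < suc m ] g (τ x)        ≡⟨ ∑-suc m (g ∘ τ) ⟩
    ∑[ x < m ] g (τ x) + g (τ m)   ≡⟨ cong (λ y → ∑[ x < m ] g (τ x) + g y) (transpose-right q m) ⟩
    ∑[ x < m ] g (τ x) + g q       ≡⟨ ∑-update m q<m (λ {x} x<m x≢q → cong g (transpose-other x≢q (ℕₚ.<⇒≢ x<m))) ⟩
    ∑ m g + g (τ q)                ≡⟨ cong (λ y → ∑ m g + g y) (transpose-left q m) ⟩
    ∑ m g + g m                    ≡⟨ ∑-suc m g ⟨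
    ∑ (suc m) g                    ∎
    where
    open ≡-Reasoning
    τ : ℕ → ℕ
    τ = transpose q m

  record SelfInjective (n : ℕ) (h : ℕ → ℕ) : Set where
    field
      bounded   : ∀ {k} → k < n → h k < n
      injective : ∀ {k l} → k < n → l < n → h k ≡ h l → k ≡ l

  -- Conjugating h by the transposition of h m and m gives a self-injection of [0, m).
  ∑-reindex : ∀ n {h} → SelfInjective n h → ∀ (g : ℕ → ℤ) → ∑[ k < n ] g (h k) ≡ ∑ n g
  ∑-reindex zero    _ g = refl
  ∑-reindex (suc m) {h} h-inj g = begin
    ∑[ k < suc m ] g (h k)
      ≡⟨ ∑-suc m (g ∘ h) ⟩
    ∑[ k < m ] g (h k) + g q
      ≡⟨ cong (_+ g q) (∑-cong m (λ {k} _ → cong g (transpose-involutive q m (h k)))) ⟨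
    ∑[ k < m ] g′ (h′ k) + g q
      ≡⟨ cong (_+ g q) (∑-reindex m h′-inj g′) ⟩
    ∑ m g′ + g q
      ≡⟨ cong (λ y → ∑ m g′ + g y) (transpose-right q m) ⟨
    ∑ m g′ + g′ m
      ≡⟨ ∑-suc m g′ ⟨
    ∑ (suc m) g′
      ≡⟨ ∑-transpose m g (ℕₚ.m<1+n⇒m≤n (bounded (ℕₚ.n<1+n m))) ⟩
    ∑ (suc m) g ∎
    where
    open ≡-Reasoning
    open SelfInjective h-inj
    q : ℕ
    q = h m
    h′ : ℕ → ℕ
    h′ = transpose q m ∘ h
    g′ : ℕ → ℤ
    g′ = g ∘ transpose q m
    h′<m : ∀ {k} → k < m → h′ k < m
    h′<m {k} k<m = ℕₚ.≤∧≢⇒< (ℕₚ.m<1+n⇒m≤n (transpose-< (bounded (ℕₚ.n<1+n m)) (ℕₚ.n<1+n m) (bounded (ℕₚ.m<n⇒m<1+n k<m))))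
                            (λ h′k≡m → ℕₚ.<⇒≢ k<m (injective (ℕₚ.m<n⇒m<1+n k<m) (ℕₚ.n<1+n m)
                                         (transpose-injective q m (trans h′k≡m (sym (transpose-left q m))))))
    h′-inj : SelfInjective m h′
    h′-inj = record
      { bounded   = h′<m
      ; injective = λ k<m l<m → injective (ℕₚ.m<n⇒m<1+n k<m) (ℕₚ.m<n⇒m<1+n l<m) ∘ transpose-injective q m
      }

  -- Reindexing the indicator of c shows that c has exactly one preimage.
  SelfInjective⇒surjective : ∀ {n h} → SelfInjective n h → ∀ {c} → c < n → ∃[ k ] (k < n × h k ≡ c)
  SelfInjective⇒surjective {n} {h} h-inj {c} c<n =
    let k , k∈ , 𝟙≢0 = sum≢0⇒nonzero (upTo n) (λ k → 𝟙 (h k ≡ᵇ c)) count≢0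
    in  k , ∈-upTo⁻ k∈ , hit (h k ≡ᵇ c) (≡ᵇ-reflects-≡ (h k) c) 𝟙≢0
    where
    count≢0 : ∑[ k < n ] 𝟙 (h k ≡ᵇ c) ≢ 0ℤ
    count≢0 count≡0 = 1≢0 (begin
      1ℤ                          ≡⟨ cong 𝟙 (<ᵇ-true c<n) ⟨
      𝟙 (c <ᵇ n)                  ≡⟨ ∑-indicator n c ⟨
      ∑[ x < n ] 𝟙 (x ≡ᵇ c)       ≡⟨ ∑-reindex n h-inj (λ x → 𝟙 (x ≡ᵇ c)) ⟨
      ∑[ k < n ] 𝟙 (h k ≡ᵇ c)     ≡⟨ count≡0 ⟩
      0ℤ                          ∎)
      where
      open ≡-Reasoning
      1≢0 : 1ℤ ≢ 0ℤ
      1≢0 ()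
    hit : ∀ {k} b → Reflects (h k ≡ c) b → 𝟙 b ≢ 0ℤ → h k ≡ c
    hit true  (ofʸ hk≡c) _   = hk≡c
    hit false _          0≢0 = ⊥-elim (0≢0 refl)

module SchurTest where
  open import Data.Rational using (ℚ; mkℚ; 0ℚ; 1ℚ; _/_; _+_; _*_; -_; _≤_; *≤*; ∣_∣; nonNegative)
  import Data.Rational.Unnormalised as ℚᵘ
  import Data.Rational.Unnormalised.Properties as ℚᵘₚ
  import Data.Nat.Coprimality as Coprime
  open import Data.Integer.Tactic.RingSolver using () renaming (solve-∀ to solve-∀ℤ)
  open import Data.Rational.Solver using (module +-*-Solver)
  open +-*-Solver using (solve; _:=_; _:+_; _:*_; :-_)
  open ListSum ℚₚ.+-*-commutativeRing

  *-nonneg : ∀ {x y} → 0ℚ ≤ x → 0ℚ ≤ y → 0ℚ ≤ x * y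
  *-nonneg {x} {y} 0≤x 0≤y = ℚₚ.nonNegative⁻¹ (x * y)
    {{ℚₚ.nonNeg*nonNeg⇒nonNeg x {{nonNegative 0≤x}} y {{nonNegative 0≤y}}}}

  square-nonneg : ∀ x → 0ℚ ≤ x * x
  square-nonneg x with ℚₚ.∣p∣≡p∨∣p∣≡-p x
  ... | inj₁ ∣x∣≡x  = *-nonneg (ℚₚ.∣p∣≡p⇒0≤p ∣x∣≡x) (ℚₚ.∣p∣≡p⇒0≤p ∣x∣≡x)
  ... | inj₂ ∣x∣≡-x = subst (0ℚ ≤_) (neg² x) (*-nonneg 0≤-x 0≤-x)
    where
    0≤-x : 0ℚ ≤ - x
    0≤-x = subst (0ℚ ≤_) ∣x∣≡-x (ℚₚ.0≤∣p∣ x)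
    neg² : ∀ x → (- x) * (- x) ≡ x * x
    neg² = solve 1 (λ x → (:- x) :* (:- x) := x :* x) refl

  ≤-+-nonneg : ∀ x {d} → 0ℚ ≤ d → x ≤ x + d
  ≤-+-nonneg x {d} 0≤d = subst (_≤ x + d) (ℚₚ.+-identityʳ x) (ℚₚ.+-monoʳ-≤ x 0≤d)

  double-product≤ : ∀ t x y → t * (x * y) + t * (x * y) ≤ ∣ t ∣ * (x * x) + ∣ t ∣ * (y * y)
  double-product≤ t x y with ℚₚ.∣p∣≡p∨∣p∣≡-p t
  ... | inj₁ ∣t∣≡t  rewrite ∣t∣≡t  = begin
    t * (x * y) + t * (x * y)
      ≤⟨ ≤-+-nonneg _ (*-nonneg (ℚₚ.∣p∣≡p⇒0≤p ∣t∣≡t) (square-nonneg (x + - y))) ⟩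
    (t * (x * y) + t * (x * y)) + t * ((x + - y) * (x + - y))
      ≡⟨ complete t x y ⟨
    t * (x * x) + t * (y * y) ∎
    where
    open ℚₚ.≤-Reasoning
    complete : ∀ t x y → t * (x * x) + t * (y * y) ≡ (t * (x * y) + t * (x * y)) + t * ((x + - y) * (x + - y))
    complete = solve 3 (λ t x y → t :* (x :* x) :+ t :* (y :* y)
                                   := (t :* (x :* y) :+ t :* (x :* y)) :+ t :* ((x :+ :- y) :* (x :+ :- y))) refl
  ... | inj₂ ∣t∣≡-t rewrite ∣t∣≡-t = begin
    t * (x * y) + t * (x * y)
      ≤⟨ ≤-+-nonneg _ (*-nonneg (subst (0ℚ ≤_) ∣t∣≡-t (ℚₚ.0≤∣p∣ t)) (square-nonneg (x + y))) ⟩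
    (t * (x * y) + t * (x * y)) + (- t) * ((x + y) * (x + y))
      ≡⟨ complete t x y ⟨
    (- t) * (x * x) + (- t) * (y * y) ∎
    where
    open ℚₚ.≤-Reasoning
    complete : ∀ t x y → (- t) * (x * x) + (- t) * (y * y) ≡ (t * (x * y) + t * (x * y)) + (- t) * ((x + y) * (x + y))
    complete = solve 3 (λ t x y → (:- t) :* (x :* x) :+ (:- t) :* (y :* y)
                                   := (t :* (x :* y) :+ t :* (x :* y)) :+ (:- t) :* ((x :+ y) :* (x :+ y))) refl

  weighted-product≤ : ∀ v w x y → (v * x) * (w * y) + (v * x) * (w * y) ≤ (∣ v ∣ * (x * x)) * ∣ w ∣ + ∣ v ∣ * (∣ w ∣ * (y * y))
  weighted-product≤ v w x y = begin
    (v * x) * (w * y) + (v * x) * (w * y)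
      ≡⟨ cong₂ _+_ (regroup v w x y) (regroup v w x y) ⟩
    (v * w) * (x * y) + (v * w) * (x * y)
      ≤⟨ double-product≤ (v * w) x y ⟩
    ∣ v * w ∣ * (x * x) + ∣ v * w ∣ * (y * y)
      ≡⟨ cong (λ s → s * (x * x) + s * (y * y)) (ℚₚ.∣p*q∣≡∣p∣*∣q∣ v w) ⟩
    (∣ v ∣ * ∣ w ∣) * (x * x) + (∣ v ∣ * ∣ w ∣) * (y * y)
      ≡⟨ spread ∣ v ∣ ∣ w ∣ x y ⟩
    (∣ v ∣ * (x * x)) * ∣ w ∣ + ∣ v ∣ * (∣ w ∣ * (y * y)) ∎
    where
    open ℚₚ.≤-Reasoning
    regroup : ∀ v w x y → (v * x) * (w * y) ≡ (v * w) * (x * y)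
    regroup = solve 4 (λ v w x y → (v :* x) :* (w :* y) := (v :* w) :* (x :* y)) refl
    spread : ∀ a b x y → (a * b) * (x * x) + (a * b) * (y * y) ≡ (a * (x * x)) * b + a * (b * (y * y))
    spread = solve 4 (λ a b x y → (a :* b) :* (x :* x) :+ (a :* b) :* (y :* y)
                                   := (a :* (x :* x)) :* b :+ a :* (b :* (y :* y))) refl

  halve-≤ : ∀ {x y} → x + x ≤ y + y → x ≤ y
  halve-≤ {x} {y} 2x≤2y = ℚₚ.*-cancelˡ-≤-pos (1ℚ + 1ℚ) (subst₂ _≤_ (doubled x) (doubled y) 2x≤2y)
    where
    doubled : ∀ z → z + z ≡ (1ℚ + 1ℚ) * z
    doubled z = trans (cong₂ _+_ (sym (ℚₚ.*-identityˡ z)) (sym (ℚₚ.*-identityˡ z))) (sym (ℚₚ.*-distribʳ-+ z 1ℚ 1ℚ))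

  -- The value of `z / 1`, built without normalisation so that it computes.
  fromℤ : ℤ → ℚ
  fromℤ z = mkℚ z 0 (Coprime.sym (Coprime.1-coprimeTo ℤ.∣ z ∣))

  /1≡fromℤ : ∀ z → z / 1 ≡ fromℤ z
  /1≡fromℤ z = ℚₚ.↥p/↧p≡p (fromℤ z)

  fromℤ-homo-+ : ∀ a b → fromℤ (a ℤ.+ b) ≡ fromℤ a + fromℤ b
  fromℤ-homo-+ a b = ℚₚ.toℚᵘ-injective (ℚᵘₚ.≃-trans (ℚᵘ.*≡* (cross a b)) (ℚᵘₚ.≃-sym (ℚₚ.toℚᵘ-homo-+ (fromℤ a) (fromℤ b))))
    where
    cross : ∀ a b → (a ℤ.+ b) ℤ.* 1ℤ ≡ (a ℤ.* 1ℤ ℤ.+ b ℤ.* 1ℤ) ℤ.* 1ℤ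
    cross = solve-∀ℤ

  fromℤ-homo-* : ∀ a b → fromℤ (a ℤ.* b) ≡ fromℤ a * fromℤ b
  fromℤ-homo-* a b = ℚₚ.toℚᵘ-injective (ℚᵘₚ.≃-sym (ℚₚ.toℚᵘ-homo-* (fromℤ a) (fromℤ b)))

  fromℤ-mono-≤ : ∀ {a b} → a ℤ.≤ b → fromℤ a ≤ fromℤ b
  fromℤ-mono-≤ {a} {b} a≤b = *≤* (subst₂ ℤ._≤_ (sym (ℤₚ.*-identityʳ a)) (sym (ℤₚ.*-identityʳ b)) a≤b)

  module _ {ℓ} {A : Set ℓ} where

    sum-mono-≤ : ∀ (xs : List A) {f g : A → ℚ} → (∀ {x} → x ∈ xs → f x ≤ g x) → sum (map f xs) ≤ sum (map g xs)
    sum-mono-≤ []       f≤g = ℚₚ.≤-refl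
    sum-mono-≤ (x ∷ xs) f≤g = ℚₚ.+-mono-≤ (f≤g (here refl)) (sum-mono-≤ xs (f≤g ∘ there))

    sum-nonneg : ∀ (xs : List A) {f : A → ℚ} → (∀ {x} → x ∈ xs → 0ℚ ≤ f x) → 0ℚ ≤ sum (map f xs)
    sum-nonneg xs {f} 0≤f = subst (_≤ sum (map f xs)) (sum-zero xs) (sum-mono-≤ xs 0≤f)

    weighted-cauchy-schwarz : ∀ (xs : List A) (w x : A → ℚ) →
      sum (map (λ f → w f * x f) xs) * sum (map (λ f → w f * x f) xs)
        ≤ sum (map (λ f → ∣ w f ∣) xs) * sum (map (λ f → ∣ w f ∣ * (x f * x f)) xs)
    weighted-cauchy-schwarz xs w x = halve-≤ (begin
      Σu * Σu + Σu * Σu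
        ≡⟨ cong₂ _+_ (sum-*-sum xs xs u u) (sum-*-sum xs xs u u) ⟩
      ∑∑ (λ f g → u f * u g) + ∑∑ (λ f g → u f * u g)
        ≡⟨ sum-distrib-+ xs _ _ ⟨
      sum (map (λ f → sum (map (λ g → u f * u g) xs) + sum (map (λ g → u f * u g) xs)) xs)
        ≡⟨ sum-cong xs (λ {f} _ → sum-distrib-+ xs (λ g → u f * u g) (λ g → u f * u g)) ⟨
      ∑∑ (λ f g → u f * u g + u f * u g)
        ≤⟨ sum-mono-≤ xs (λ {f} _ → sum-mono-≤ xs (λ {g} _ → weighted-product≤ (w f) (w g) (x f) (x g))) ⟩
      ∑∑ (λ f g → b f * a g + a f * b g)
        ≡⟨ sum-cong xs (λ {f} _ → sum-distrib-+ xs (λ g → b f * a g) (λ g → a f * b g)) ⟩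
      sum (map (λ f → sum (map (λ g → b f * a g) xs) + sum (map (λ g → a f * b g) xs)) xs)
        ≡⟨ sum-distrib-+ xs _ _ ⟩
      ∑∑ (λ f g → b f * a g) + ∑∑ (λ f g → a f * b g)
        ≡⟨ cong₂ _+_ (sum-*-sum xs xs b a) (sum-*-sum xs xs a b) ⟨
      Σb * Σa + Σa * Σb
        ≡⟨ cong (_+ Σa * Σb) (ℚₚ.*-comm Σb Σa) ⟩
      Σa * Σb + Σa * Σb ∎)
      where
      open ℚₚ.≤-Reasoning
      u a b : A → ℚ
      u f = w f * x f
      a f = ∣ w f ∣
      b f = ∣ w f ∣ * (x f * x f)
      Σu Σa Σb : ℚ
      Σu = sum (map u xs)
      Σa = sum (map a xs)
      Σb = sum (map b xs)
      ∑∑ : (A → A → ℚ) → ℚ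
      ∑∑ F = sum (map (λ f → sum (map (F f) xs)) xs)

    schur-test : ∀ (xs : List A) (w : A → A → ℚ) {R} → 0ℚ ≤ R →
      (∀ {e} → e ∈ xs → sum (map (λ f → ∣ w e f ∣) xs) ≤ R) →
      (∀ {f} → f ∈ xs → sum (map (λ e → ∣ w e f ∣) xs) ≤ R) →
      ∀ (x : A → ℚ) →
      sum (map (λ e → sum (map (λ f → w e f * x f) xs) * sum (map (λ f → w e f * x f) xs)) xs)
        ≤ (R * R) * sum (map (λ e → x e * x e) xs)
    schur-test xs w {R} 0≤R rows≤R columns≤R x = begin
      sum (map (λ e → sum (map (λ f → w e f * x f) xs) * sum (map (λ f → w e f * x f) xs)) xs)
        ≤⟨ sum-mono-≤ xs (λ {e} _ → weighted-cauchy-schwarz xs (w e) x) ⟩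
      sum (map (λ e → sum (map (λ f → ∣ w e f ∣) xs) * B e) xs)
        ≤⟨ sum-mono-≤ xs (λ {e} e∈ → ℚₚ.*-monoʳ-≤-nonNeg (B e) {{nonNegative (B-nonneg e)}} (rows≤R e∈)) ⟩
      sum (map (λ e → R * B e) xs)
        ≡⟨ *-distribˡ-sum R xs B ⟨
      R * sum (map B xs)
        ≡⟨ cong (R *_) (sum-comm xs xs (λ e f → ∣ w e f ∣ * (x f * x f))) ⟩
      R * sum (map (λ f → sum (map (λ e → ∣ w e f ∣ * (x f * x f)) xs)) xs)
        ≡⟨ cong (R *_) (sum-cong xs (λ {f} _ → column f)) ⟩
      R * sum (map (λ f → sum (map (λ e → ∣ w e f ∣) xs) * (x f * x f)) xs)
        ≤⟨ ℚₚ.*-monoˡ-≤-nonNeg R {{nonNegative 0≤R}} (sum-mono-≤ xs (λ {f} f∈ →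
             ℚₚ.*-monoʳ-≤-nonNeg (x f * x f) {{nonNegative (square-nonneg (x f))}} (columns≤R f∈))) ⟩
      R * sum (map (λ f → R * (x f * x f)) xs)
        ≡⟨ cong (R *_) (*-distribˡ-sum R xs (λ f → x f * x f)) ⟨
      R * (R * sum (map (λ f → x f * x f) xs))
        ≡⟨ ℚₚ.*-assoc R R _ ⟨
      (R * R) * sum (map (λ e → x e * x e) xs) ∎
      where
      open ℚₚ.≤-Reasoning
      B : A → ℚ
      B e = sum (map (λ f → ∣ w e f ∣ * (x f * x f)) xs)
      B-nonneg : ∀ e → 0ℚ ≤ B e
      B-nonneg e = sum-nonneg xs (λ {f} _ → *-nonneg (ℚₚ.0≤∣p∣ (w e f)) (square-nonneg (x f)))
      column : ∀ f → sum (map (λ e → ∣ w e f ∣ * (x f * x f)) xs) ≡ sum (map (λ e → ∣ w e f ∣) xs) * (x f * x f)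
      column f = trans (sum-cong xs (λ {e} _ → ℚₚ.*-comm ∣ w e f ∣ (x f * x f)))
                       (trans (sym (*-distribˡ-sum (x f * x f) xs (λ e → ∣ w e f ∣))) (ℚₚ.*-comm (x f * x f) _))

    sum-fromℤ : ∀ (xs : List A) (g : A → ℤ) → sum (map (fromℤ ∘ g) xs) ≡ fromℤ (sumℤ (map g xs))
    sum-fromℤ []       g = refl
    sum-fromℤ (x ∷ xs) g = trans (cong (fromℤ (g x) +_) (sum-fromℤ xs g)) (sym (fromℤ-homo-+ (g x) _))

    schur-test-ℤ : ∀ (xs : List A) (w : A → A → ℤ) R →
      (∀ {e} → e ∈ xs → sumℤ (map (λ f → ℤ.+ ℤ.∣ w e f ∣) xs) ℤ.≤ ℤ.+ R) →
      (∀ {f} → f ∈ xs → sumℤ (map (λ e → ℤ.+ ℤ.∣ w e f ∣) xs) ℤ.≤ ℤ.+ R) →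
      ∀ (x : A → ℚ) →
      sum (map (λ e → sum (map (λ f → (w e f / 1) * x f) xs) * sum (map (λ f → (w e f / 1) * x f) xs)) xs)
        ≤ (ℤ.+ (R ℕ.* R) / 1) * sum (map (λ e → x e * x e) xs)
    schur-test-ℤ xs w R rows≤R columns≤R x =
      subst (λ r → _ ≤ r * sum (map (λ e → x e * x e) xs)) R²
        (schur-test xs (λ e f → w e f / 1) {fromℤ (ℤ.+ R)} (fromℤ-mono-≤ (ℤ.+≤+ ℕ.z≤n))
          (λ {e} e∈ → bound (w e) (rows≤R e∈)) (λ {f} f∈ → bound (λ e → w e f) (columns≤R f∈)) x)
      where
      ∣/1∣ : ∀ z → ∣ z / 1 ∣ ≡ fromℤ (ℤ.+ ℤ.∣ z ∣)
      ∣/1∣ z = cong ∣_∣ (/1≡fromℤ z)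
      bound : ∀ (g : A → ℤ) → sumℤ (map (λ y → ℤ.+ ℤ.∣ g y ∣) xs) ℤ.≤ ℤ.+ R →
              sum (map (λ y → ∣ g y / 1 ∣) xs) ≤ fromℤ (ℤ.+ R)
      bound g Σ≤R = subst (_≤ fromℤ (ℤ.+ R))
        (sym (trans (sum-cong xs (λ {y} _ → ∣/1∣ (g y))) (sum-fromℤ xs (λ y → ℤ.+ ℤ.∣ g y ∣))))
        (fromℤ-mono-≤ Σ≤R)
      R² : fromℤ (ℤ.+ R) * fromℤ (ℤ.+ R) ≡ ℤ.+ (R ℕ.* R) / 1
      R² = trans (sym (fromℤ-homo-* (ℤ.+ R) (ℤ.+ R))) (trans (cong fromℤ (sym (ℤₚ.pos-* R R))) (sym (/1≡fromℤ _)))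

module Congruence (p : ℕ) .{{_ : NonZero p}} where
  open import Data.Nat using (_+_; _*_; _∸_; _<_; _≤_)
  open import Data.Nat.DivMod using (_%_; m%n%n≡m%n; m<n⇒m%n≡m; %-distribˡ-+; %-distribˡ-*; m%n<n;
                                     m≤n⇒[n∸m]%m≡n%m; [m+n]%n≡m%n; [m+kn]%n≡m%n)
  open import Data.Nat.Tactic.RingSolver using (solve-∀)

  infix 4 _≈_ _≉_
  _≈_ : ℕ → ℕ → Set
  a ≈ b = a % p ≡ b % p

  _≉_ : ℕ → ℕ → Set
  a ≉ b = ¬ a ≈ b

  0%p≡0 : 0 % p ≡ 0
  0%p≡0 = m<n⇒m%n≡m (ℕ.>-nonZero⁻¹ p)

  %-≈ : ∀ a → a % p ≈ a
  %-≈ a = m%n%n≡m%n a p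

  ≈⇒≡ : ∀ {a b} → a < p → b < p → a ≈ b → a ≡ b
  ≈⇒≡ a<p b<p a≈b = trans (sym (m<n⇒m%n≡m a<p)) (trans a≈b (m<n⇒m%n≡m b<p))

  +-cong-≈ : ∀ {a b c d} → a ≈ b → c ≈ d → a + c ≈ b + d
  +-cong-≈ {a} {b} {c} {d} a≈b c≈d = begin
    (a + c) % p                ≡⟨ %-distribˡ-+ a c p ⟩
    (a % p + c % p) % p        ≡⟨ cong₂ (λ x y → (x + y) % p) a≈b c≈d ⟩
    (b % p + d % p) % p        ≡⟨ %-distribˡ-+ b d p ⟨
    (b + d) % p                ∎
    where open ≡-Reasoning

  *-cong-≈ : ∀ {a b c d} → a ≈ b → c ≈ d → a * c ≈ b * d
  *-cong-≈ {a} {b} {c} {d} a≈b c≈d = begin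
    (a * c) % p                ≡⟨ %-distribˡ-* a c p ⟩
    (a % p * (c % p)) % p      ≡⟨ cong₂ (λ x y → (x * y) % p) a≈b c≈d ⟩
    (b % p * (d % p)) % p      ≡⟨ %-distribˡ-* b d p ⟨
    (b * d) % p                ∎
    where open ≡-Reasoning

  neg : ℕ → ℕ
  neg a = p ∸ a % p

  neg-inverse : ∀ a → neg a + a ≈ 0
  neg-inverse a = begin
    (p ∸ a % p + a) % p        ≡⟨ +-cong-≈ {p ∸ a % p} refl (sym (%-≈ a)) ⟩
    (p ∸ a % p + a % p) % p    ≡⟨ cong (_% p) (ℕₚ.m∸n+n≡m (ℕₚ.<⇒≤ (m%n<n a p))) ⟩
    p % p                      ≡⟨ [m+n]%n≡m%n 0 p ⟩
    0 % p                      ∎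
    where open ≡-Reasoning

  +-cancelˡ-≈ : ∀ c {a b} → c + a ≈ c + b → a ≈ b
  +-cancelˡ-≈ c {a} {b} c+a≈c+b = begin
    a % p                      ≡⟨ +-cong-≈ (neg-inverse c) refl ⟨
    (neg c + c + a) % p        ≡⟨ cong (_% p) (ℕₚ.+-assoc (neg c) c a) ⟩
    (neg c + (c + a)) % p      ≡⟨ +-cong-≈ {neg c} refl c+a≈c+b ⟩
    (neg c + (c + b)) % p      ≡⟨ cong (_% p) (ℕₚ.+-assoc (neg c) c b) ⟨
    (neg c + c + b) % p        ≡⟨ +-cong-≈ (neg-inverse c) refl ⟩
    b % p                      ∎
    where open ≡-Reasoning

  ∸-square-≈ : ∀ {y} → y ≤ p → (p ∸ y) * (p ∸ y) ≈ y * y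
  ∸-square-≈ {y} y≤p = begin
    (z * z) % p                  ≡⟨ [m+kn]%n≡m%n (z * z) y p ⟨
    (z * z + y * p) % p          ≡⟨ cong (λ w → (z * z + y * w) % p) z+y≡p ⟨
    (z * z + y * (z + y)) % p    ≡⟨ cong (_% p) (swap-squares z y) ⟩
    (y * y + z * (z + y)) % p    ≡⟨ cong (λ w → (y * y + z * w) % p) z+y≡p ⟩
    (y * y + z * p) % p          ≡⟨ [m+kn]%n≡m%n (y * y) z p ⟩
    (y * y) % p                  ∎
    where
    open ≡-Reasoning
    z : ℕ
    z = p ∸ y
    z+y≡p : z + y ≡ p
    z+y≡p = ℕₚ.m∸n+n≡m y≤p
    swap-squares : ∀ a b → a * a + b * (a + b) ≡ b * b + a * (a + b)
    swap-squares = solve-∀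

  reflection-shift : ∀ {a b k} → b < p → k < p → (b + p) ∸ k + ((a + p) ∸ b) ≡ (a + p) ∸ k + p
  reflection-shift {a} {b} {k} b<p k<p = ℕₚ.+-cancelʳ-≡ (k + b) _ _ (begin
    ((b + p) ∸ k + ((a + p) ∸ b)) + (k + b)  ≡⟨ regroup ((b + p) ∸ k) ((a + p) ∸ b) k b ⟩
    ((b + p) ∸ k + k) + ((a + p) ∸ b + b)    ≡⟨ cong₂ _+_ (ℕₚ.m∸n+n≡m (≤-n+p b k<p)) (ℕₚ.m∸n+n≡m (≤-n+p a b<p)) ⟩
    (b + p) + (a + p)                        ≡⟨ swap a b p ⟩
    (a + p) + (p + b)                        ≡⟨ cong (_+ (p + b)) (ℕₚ.m∸n+n≡m (≤-n+p a k<p)) ⟨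
    ((a + p) ∸ k + k) + (p + b)              ≡⟨ regroup ((a + p) ∸ k) p k b ⟨
    ((a + p) ∸ k + p) + (k + b)              ∎)
    where
    open ≡-Reasoning
    ≤-n+p : ∀ n {m} → m < p → m ≤ n + p
    ≤-n+p n m<p = ℕₚ.≤-trans (ℕₚ.<⇒≤ m<p) (ℕₚ.m≤n+m p n)
    regroup : ∀ x y k b → (x + y) + (k + b) ≡ (x + k) + (y + b)
    regroup = solve-∀
    swap : ∀ a b q → (b + q) + (a + q) ≡ (a + q) + (q + b)
    swap = solve-∀

  divisible-*ˡ : ∀ {a} b → a % p ≡ 0 → (a * b) % p ≡ 0
  divisible-*ˡ {a} b a≡0 = trans (*-cong-≈ {a} {0} {b} {b} (trans a≡0 (sym 0%p≡0)) refl) 0%p≡0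

  divisible-*ʳ : ∀ a {b} → b % p ≡ 0 → (a * b) % p ≡ 0
  divisible-*ʳ a {b} b≡0 = trans (cong (_% p) (ℕₚ.*-comm a b)) (divisible-*ˡ a b≡0)

  divisible<2p⇒0∨p : ∀ {s} → s < p + p → s % p ≡ 0 → s ≡ 0 ⊎ s ≡ p
  divisible<2p⇒0∨p {s} s<2p s%p≡0 with s ℕ.<? p
  ... | yes s<p = inj₁ (trans (sym (m<n⇒m%n≡m s<p)) s%p≡0)
  ... | no  s≮p = inj₂ (ℕₚ.≤-antisym (ℕₚ.m∸n≡0⇒m≤n s∸p≡0) p≤s)
    where
    p≤s : p ≤ s
    p≤s = ℕₚ.≮⇒≥ s≮p
    s∸p≡0 : s ∸ p ≡ 0
    s∸p≡0 = begin
      s ∸ p           ≡⟨ m<n⇒m%n≡m (ℕₚ.+-cancelˡ-< p _ _ (subst (_< p + p) (sym (ℕₚ.m+[n∸m]≡n p≤s)) s<2p)) ⟨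
      (s ∸ p) % p     ≡⟨ m≤n⇒[n∸m]%m≡n%m p≤s ⟩
      s % p           ≡⟨ s%p≡0 ⟩
      0               ∎
      where open ≡-Reasoning

module PrimeCongruence (p : ℕ) .{{_ : NonZero p}} (p-prime : Prime p) where
  open import Data.Nat using (_+_; _*_; _∸_; _<_; _≤_)
  open import Data.Nat.DivMod using (_%_; m<n⇒m%n≡m)
  open import Data.Nat.Divisibility using (m%n≡0⇒n∣m; n∣m⇒m%n≡0)
  open import Data.Nat.Tactic.RingSolver using (solve-∀)
  open Congruence p

  euclidsLemma-% : ∀ a b → (a * b) % p ≡ 0 → a % p ≡ 0 ⊎ b % p ≡ 0
  euclidsLemma-% a b ab≡0 with euclidsLemma a b p-prime (m%n≡0⇒n∣m (a * b) p ab≡0)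
  ... | inj₁ p∣a = inj₁ (n∣m⇒m%n≡0 a p p∣a)
  ... | inj₂ p∣b = inj₂ (n∣m⇒m%n≡0 b p p∣b)

  *-nonzero : ∀ {a b} → a % p ≢ 0 → b % p ≢ 0 → (a * b) % p ≢ 0
  *-nonzero {a} {b} a≢0 b≢0 ab≡0 with euclidsLemma-% a b ab≡0
  ... | inj₁ a≡0 = a≢0 a≡0
  ... | inj₂ b≡0 = b≢0 b≡0

  *-cancelˡ-≈ : ∀ {u a b} → u % p ≢ 0 → u * a ≈ u * b → a ≈ b
  *-cancelˡ-≈ {u} {a} {b} u≢0 ua≈ub with euclidsLemma-% u (a + neg b) u[a-b]≡0
    where
    u[a-b]≡0 : (u * (a + neg b)) % p ≡ 0
    u[a-b]≡0 = begin
      (u * (a + neg b)) % p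
        ≡⟨ cong (_% p) (ℕₚ.*-distribˡ-+ u a (neg b)) ⟩
      (u * a + u * neg b) % p
        ≡⟨ +-cong-≈ ua≈ub (refl {x = (u * neg b) % p}) ⟩
      (u * b + u * neg b) % p
        ≡⟨ cong (_% p) (ℕₚ.*-distribˡ-+ u b (neg b)) ⟨
      (u * (b + neg b)) % p
        ≡⟨ *-cong-≈ {u} refl (trans (cong (_% p) (ℕₚ.+-comm b (neg b))) (neg-inverse b)) ⟩
      (u * 0) % p
        ≡⟨ cong (_% p) (ℕₚ.*-zeroʳ u) ⟩
      0 % p
        ≡⟨ 0%p≡0 ⟩
      0 ∎
      where open ≡-Reasoning
  ... | inj₁ u≡0   = ⊥-elim (u≢0 u≡0)
  ... | inj₂ a-b≡0 = begin
      a % p                        ≡⟨ cong (_% p) (ℕₚ.+-identityʳ a) ⟨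
      (a + 0) % p                  ≡⟨ +-cong-≈ {a} refl (neg-inverse b) ⟨
      (a + (neg b + b)) % p        ≡⟨ cong (_% p) (ℕₚ.+-assoc a (neg b) b) ⟨
      (a + neg b + b) % p          ≡⟨ +-cong-≈ {a + neg b} {0} (trans a-b≡0 (sym 0%p≡0)) refl ⟩
      b % p                        ∎
      where open ≡-Reasoning

  private
    square-roots-≤ : ∀ {y z} → z ≤ y → y < p → y * y ≈ z * z → y ≡ z ⊎ y + z ≡ p
    square-roots-≤ {y} {z} z≤y y<p y²≈z² with euclidsLemma-% d (y + z) d[y+z]≡0
      where
      d : ℕ
      d = y ∸ z
      y≡z+d : y ≡ z + d
      y≡z+d = sym (ℕₚ.m+[n∸m]≡n z≤y)
      expand : ∀ z d → (z + d) * (z + d) ≡ z * z + d * ((z + d) + z)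
      expand = solve-∀
      d[y+z]≡0 : (d * (y + z)) % p ≡ 0
      d[y+z]≡0 = trans (+-cancelˡ-≈ (z * z) (begin
        (z * z + d * (y + z)) % p
          ≡⟨ cong (_% p) (trans (cong (λ w → w * w) y≡z+d) (trans (expand z d) (cong (λ w → z * z + d * (w + z)) (sym y≡z+d)))) ⟨
        (y * y) % p
          ≡⟨ y²≈z² ⟩
        (z * z) % p
          ≡⟨ cong (_% p) (ℕₚ.+-identityʳ (z * z)) ⟨
        (z * z + 0) % p ∎)) 0%p≡0
        where open ≡-Reasoning
    ... | inj₁ d≡0   = inj₁ (begin
      y                ≡⟨ ℕₚ.m+[n∸m]≡n z≤y ⟨
      z + (y ∸ z)      ≡⟨ cong (z +_) (trans (sym (m<n⇒m%n≡m (ℕₚ.≤-<-trans (ℕₚ.m∸n≤m y z) y<p))) d≡0) ⟩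
      z + 0            ≡⟨ ℕₚ.+-identityʳ z ⟩
      z                ∎)
      where open ≡-Reasoning
    ... | inj₂ y+z≡0 with divisible<2p⇒0∨p (ℕₚ.+-mono-< y<p (ℕₚ.≤-<-trans z≤y y<p)) y+z≡0
    ...   | inj₁ y+z≡0′ = inj₁ (trans (ℕₚ.m+n≡0⇒m≡0 y y+z≡0′) (sym (ℕₚ.m+n≡0⇒n≡0 y y+z≡0′)))
    ...   | inj₂ y+z≡p  = inj₂ y+z≡p

  square-roots : ∀ {y z} → y < p → z < p → y * y ≈ z * z → y ≡ z ⊎ y + z ≡ p
  square-roots {y} {z} y<p z<p y²≈z² with ℕₚ.≤-total z y
  ... | inj₁ z≤y = square-roots-≤ z≤y y<p y²≈z²
  ... | inj₂ y≤z with square-roots-≤ y≤z z<p (sym y²≈z²)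
  ...   | inj₁ z≡y   = inj₁ (sym z≡y)
  ...   | inj₂ z+y≡p = inj₂ (trans (ℕₚ.+-comm y z) z+y≡p)

module LegendreSymbol (p : ℕ) .{{_ : NonZero p}} (p-prime : Prime p) (p-odd : ∀ y → y ℕ.+ y ≢ p) where
  open import Data.Nat using (_+_; _*_; _∸_; _<_)
  open import Data.Nat.DivMod using (_%_; m<n⇒m%n≡m; m%n<n; [m+n]%n≡m%n)
  open import Data.Nat.Tactic.RingSolver using (solve-∀)
  open import Data.Integer.Tactic.RingSolver using () renaming (solve-∀ to solve-∀ℤ)
  open import Algebra.Properties.AbelianGroup ℤₚ.+-0-abelianGroup using () renaming (∙-cancelˡ to +-cancelˡ)
  open import Algebra.Properties.CommutativeSemigroup ℤₚ.*-commutativeSemigroup using () renaming (interchange to *-interchange)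
  open IntegerSum
  open Congruence p
  open PrimeCongruence p p-prime

  χ : ℕ → ℤ
  χ = legendre p

  -- `χ x` is definitionally `symbol (x % p)`.
  private
    sign : Bool → Bool → ℤ
    sign isZero isSquare = if isZero then 0ℤ else if isSquare then 1ℤ else -1ℤ

    isSquareMod : ℕ → Bool
    isSquareMod r = any (λ y → (y * y) % p ≡ᵇ r) (upTo p)

    symbol : ℕ → ℤ
    symbol r = sign (r ≡ᵇ 0) (isSquareMod r)

    isSquareMod⇒root : ∀ {r} → isSquareMod r ≡ true → ∃[ y ] (y < p × (y * y) % p ≡ r)
    isSquareMod⇒root {r} sq =
      let y , y∈ , y²≡r = find (any⁻ _ (upTo p) (Equivalence.from T-≡ sq))
      in  y , ∈-upTo⁻ y∈ , ℕₚ.≡ᵇ⇒≡ _ r y²≡r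

    root⇒isSquareMod : ∀ {r y} → y < p → (y * y) % p ≡ r → isSquareMod r ≡ true
    root⇒isSquareMod {r} y<p y²≡r =
      Equivalence.to T-≡ (any⁺ _ (lose (∈-upTo⁺ y<p) (ℕₚ.≡⇒≡ᵇ _ r y²≡r)))

  χ-cong : ∀ {x y} → x ≈ y → χ x ≡ χ y
  χ-cong = cong symbol

  χ-divisible : ∀ {x} → x % p ≡ 0 → χ x ≡ 0ℤ
  χ-divisible = cong symbol

  χ-square : ∀ {x y} → x % p ≢ 0 → y < p → y * y ≈ x → χ x ≡ 1ℤ
  χ-square x≢0 y<p y²≈x = cong₂ sign (≡ᵇ-false x≢0) (root⇒isSquareMod y<p y²≈x)

  data Residuosity (x : ℕ) : Set where
    divisible  : x % p ≡ 0 → χ x ≡ 0ℤ → Residuosity x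
    residue    : x % p ≢ 0 → χ x ≡ 1ℤ → ∀ y → y < p → y * y ≈ x → Residuosity x
    nonresidue : x % p ≢ 0 → χ x ≡ -1ℤ → (∀ {y} → y < p → y * y ≉ x) → Residuosity x

  residuosity : ∀ x → Residuosity x
  residuosity x with x % p ≟ 0
  ... | yes x≡0 = divisible x≡0 (χ-divisible x≡0)
  ... | no  x≢0 with isSquareMod (x % p) in sq
  ...   | true  = let y , y<p , y²≈x = isSquareMod⇒root sq
                  in  residue x≢0 (χ-square x≢0 y<p y²≈x) y y<p y²≈x
  ...   | false = nonresidue x≢0 (cong₂ sign (≡ᵇ-false x≢0) sq)
                    (λ y<p y²≈x → true≢false (trans (sym (root⇒isSquareMod y<p y²≈x)) sq))
    where
    true≢false : true ≢ false
    true≢false ()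

  χ²≡1 : ∀ {x} → x % p ≢ 0 → χ x ℤ.* χ x ≡ 1ℤ
  χ²≡1 {x} x≢0 with residuosity x
  ... | divisible x≡0 _     = ⊥-elim (x≢0 x≡0)
  ... | residue _ χx≡1 _ _ _ rewrite χx≡1 = refl
  ... | nonresidue _ χx≡-1 _ rewrite χx≡-1 = refl

  ∣χ∣≤1 : ∀ x → ℤ.∣ χ x ∣ ℕ.≤ 1
  ∣χ∣≤1 x with residuosity x
  ... | divisible _ χx≡0 rewrite χx≡0 = ℕ.z≤n
  ... | residue _ χx≡1 _ _ _ rewrite χx≡1 = ℕₚ.≤-refl
  ... | nonresidue _ χx≡-1 _ rewrite χx≡-1 = ℕₚ.≤-refl

  χ≤1 : ∀ x → χ x ℤ.≤ 1ℤ
  χ≤1 x with residuosity x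
  ... | divisible _ χx≡0 rewrite χx≡0 = ℤ.+≤+ ℕ.z≤n
  ... | residue _ χx≡1 _ _ _ rewrite χx≡1 = ℤₚ.≤-refl
  ... | nonresidue _ χx≡-1 _ rewrite χx≡-1 = ℤ.-≤+

  squareRoots : ℕ → ℤ
  squareRoots z = ∑[ y < p ] 𝟙 ((y * y) % p ≡ᵇ z % p)

  private
    squareRoots-divisible : ∀ {z} → z % p ≡ 0 → squareRoots z ≡ 1ℤ
    squareRoots-divisible {z} z≡0 = begin
      ∑[ y < p ] 𝟙 ((y * y) % p ≡ᵇ z % p)   ≡⟨ ∑-cong p (cong 𝟙 ∘ only-zero) ⟩
      ∑[ y < p ] 𝟙 (y ≡ᵇ 0)                 ≡⟨ ∑-indicator p 0 ⟩
      𝟙 (0 <ᵇ p)                            ≡⟨ cong 𝟙 (<ᵇ-true (ℕ.>-nonZero⁻¹ p)) ⟩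
      1ℤ                                    ∎
      where
      open ≡-Reasoning
      only-zero : ∀ {y} → y < p → ((y * y) % p ≡ᵇ z % p) ≡ (y ≡ᵇ 0)
      only-zero {y} y<p with y ≟ 0
      ... | yes refl = ≡ᵇ-true (trans 0%p≡0 (sym z≡0))
      ... | no  y≢0  = trans (≡ᵇ-false (λ y²≈z → *-nonzero y%p≢0 y%p≢0 (trans y²≈z z≡0))) (sym (≡ᵇ-false y≢0))
        where
        y%p≢0 : y % p ≢ 0
        y%p≢0 y%p≡0 = y≢0 (trans (sym (m<n⇒m%n≡m y<p)) y%p≡0)

    squareRoots-nonsquare : ∀ {z} → (∀ {y} → y < p → y * y ≉ z) → squareRoots z ≡ 0ℤ
    squareRoots-nonsquare no-root = trans (∑-cong p (cong 𝟙 ∘ ≡ᵇ-false ∘ no-root)) (sum-zero (upTo p))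

    squareRoots-square : ∀ {z y₀} → z % p ≢ 0 → y₀ < p → y₀ * y₀ ≈ z → squareRoots z ≡ 1ℤ ℤ.+ 1ℤ
    squareRoots-square {z} {y₀} z≢0 y₀<p y₀²≈z = begin
      ∑[ y < p ] 𝟙 ((y * y) % p ≡ᵇ z % p)
        ≡⟨ ∑-cong p two-roots ⟩
      ∑[ y < p ] (𝟙 (y ≡ᵇ y₀) ℤ.+ 𝟙 (y ≡ᵇ y₁))
        ≡⟨ sum-distrib-+ (upTo p) _ _ ⟩
      ∑[ y < p ] 𝟙 (y ≡ᵇ y₀) ℤ.+ ∑[ y < p ] 𝟙 (y ≡ᵇ y₁)
        ≡⟨ cong₂ ℤ._+_ (∑-indicator p y₀) (∑-indicator p y₁) ⟩
      𝟙 (y₀ <ᵇ p) ℤ.+ 𝟙 (y₁ <ᵇ p)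
        ≡⟨ cong₂ ℤ._+_ (cong 𝟙 (<ᵇ-true y₀<p)) (cong 𝟙 (<ᵇ-true y₁<p)) ⟩
      1ℤ ℤ.+ 1ℤ ∎
      where
      open ≡-Reasoning
      y₁ : ℕ
      y₁ = p ∸ y₀
      y₀≢0 : y₀ ≢ 0
      y₀≢0 refl = z≢0 (trans (sym y₀²≈z) 0%p≡0)
      y₁<p : y₁ < p
      y₁<p = ℕₚ.∸-monoʳ-< (ℕₚ.n≢0⇒n>0 y₀≢0) (ℕₚ.<⇒≤ y₀<p)
      y₁+y₀≡p : y₁ + y₀ ≡ p
      y₁+y₀≡p = ℕₚ.m∸n+n≡m (ℕₚ.<⇒≤ y₀<p)
      y₀≢y₁ : y₀ ≢ y₁
      y₀≢y₁ y₀≡y₁ = p-odd y₀ (trans (cong (y₀ +_) y₀≡y₁) (trans (ℕₚ.+-comm y₀ y₁) y₁+y₀≡p))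
      two-roots : ∀ {y} → y < p → 𝟙 ((y * y) % p ≡ᵇ z % p) ≡ 𝟙 (y ≡ᵇ y₀) ℤ.+ 𝟙 (y ≡ᵇ y₁)
      two-roots {y} y<p with y ≟ y₀ | y ≟ y₁
      ... | yes refl | _       rewrite ≡ᵇ-true y₀²≈z | ≡ᵇ-true (refl {x = y}) | ≡ᵇ-false y₀≢y₁ = refl
      ... | no y≢y₀  | yes refl
        rewrite ≡ᵇ-true (trans (∸-square-≈ (ℕₚ.<⇒≤ y₀<p)) y₀²≈z) | ≡ᵇ-false y≢y₀ | ≡ᵇ-true (refl {x = y}) = refl
      ... | no y≢y₀  | no y≢y₁ rewrite ≡ᵇ-false y≢y₀ | ≡ᵇ-false y≢y₁ = cong 𝟙 (≡ᵇ-false not-a-root)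
        where
        not-a-root : y * y ≉ z
        not-a-root y²≈z with square-roots y<p y₀<p (trans y²≈z (sym y₀²≈z))
        ... | inj₁ y≡y₀   = y≢y₀ y≡y₀
        ... | inj₂ y+y₀≡p = y≢y₁ (ℕₚ.+-cancelʳ-≡ y₀ y y₁ (trans y+y₀≡p (sym y₁+y₀≡p)))

  squareRoots≡1+χ : ∀ z → squareRoots z ≡ 1ℤ ℤ.+ χ z
  squareRoots≡1+χ z with residuosity z
  ... | divisible z≡0 χz≡0                 rewrite χz≡0  = squareRoots-divisible z≡0
  ... | residue z≢0 χz≡1 y₀ y₀<p y₀²≈z     rewrite χz≡1  = squareRoots-square z≢0 y₀<p y₀²≈z
  ... | nonresidue _ χz≡-1 no-root         rewrite χz≡-1 = squareRoots-nonsquare no-root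

  -- Double counting: z has 1 + χ z square roots, and each y is a square root of exactly one z.
  ∑χ≡0 : ∑[ x < p ] χ x ≡ 0ℤ
  ∑χ≡0 = +-cancelˡ (ℤ.+ p) (∑ p χ) 0ℤ (begin
    ℤ.+ p ℤ.+ ∑ p χ
      ≡⟨ cong (ℤ._+ ∑ p χ) p≡∑1 ⟩
    ∑[ z < p ] 1ℤ ℤ.+ ∑ p χ
      ≡⟨ sum-distrib-+ (upTo p) (λ _ → 1ℤ) χ ⟨
    ∑[ z < p ] (1ℤ ℤ.+ χ z)
      ≡⟨ ∑-cong p (λ {z} _ → squareRoots≡1+χ z) ⟨
    ∑[ z < p ] squareRoots z
      ≡⟨ sum-comm (upTo p) (upTo p) (λ z y → 𝟙 ((y * y) % p ≡ᵇ z % p)) ⟩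
    ∑[ y < p ] (∑[ z < p ] 𝟙 ((y * y) % p ≡ᵇ z % p))
      ≡⟨ ∑-cong p (λ {y} _ → one-class y) ⟩
    ∑[ y < p ] 1ℤ
      ≡⟨ p≡∑1 ⟨
    ℤ.+ p
      ≡⟨ ℤₚ.+-identityʳ (ℤ.+ p) ⟨
    ℤ.+ p ℤ.+ 0ℤ ∎)
    where
    open ≡-Reasoning
    p≡∑1 : ℤ.+ p ≡ ∑[ _ < p ] 1ℤ
    p≡∑1 = sym (trans (∑-const p 1ℤ) (ℤₚ.*-identityʳ (ℤ.+ p)))
    one-class : ∀ y → ∑[ z < p ] 𝟙 ((y * y) % p ≡ᵇ z % p) ≡ 1ℤ
    one-class y = begin
      ∑[ z < p ] 𝟙 ((y * y) % p ≡ᵇ z % p)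
        ≡⟨ ∑-cong p (λ {z} z<p → cong 𝟙 (trans (cong ((y * y) % p ≡ᵇ_) (m<n⇒m%n≡m z<p)) (≡ᵇ-sym _ z))) ⟩
      ∑[ z < p ] 𝟙 (z ≡ᵇ (y * y) % p)
        ≡⟨ ∑-indicator p ((y * y) % p) ⟩
      𝟙 ((y * y) % p <ᵇ p)
        ≡⟨ cong 𝟙 (<ᵇ-true (m%n<n (y * y) p)) ⟩
      1ℤ ∎

  ∑χ-reindexed : ∀ (h : ℕ → ℕ) → SelfInjective p (λ k → h k % p) → ∑[ k < p ] χ (h k) ≡ 0ℤ
  ∑χ-reindexed h h%p-inj = begin
    ∑[ k < p ] χ (h k)          ≡⟨ ∑-cong p (λ {k} _ → χ-cong (sym (%-≈ (h k)))) ⟩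
    ∑[ k < p ] χ (h k % p)      ≡⟨ ∑-reindex p h%p-inj χ ⟩
    ∑[ x < p ] χ x              ≡⟨ ∑χ≡0 ⟩
    0ℤ                          ∎
    where open ≡-Reasoning

  scaling-selfInjective : ∀ {u} → u % p ≢ 0 → SelfInjective p (λ k → (u * k) % p)
  scaling-selfInjective u≢0 = record
    { bounded   = λ {k} _ → m%n<n _ p
    ; injective = λ k<p l<p uk≈ul → ≈⇒≡ k<p l<p (*-cancelˡ-≈ u≢0 uk≈ul)
    }

  root-nonzero : ∀ u {x} → u * u ≈ x → x % p ≢ 0 → u % p ≢ 0
  root-nonzero u u²≈x x≢0 u≡0 = x≢0 (trans (sym u²≈x) (divisible-*ˡ u u≡0))

  square-*-cancelˡ : ∀ u {y w} → u % p ≢ 0 → w < p → w * w ≈ (u * u) * y → ∃[ k ] (k < p × k * k ≈ y)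
  square-*-cancelˡ u {y} {w} u≢0 w<p w²≈u²y =
    let k , k<p , uk≡w = SelfInjective⇒surjective (scaling-selfInjective u≢0) w<p
        uk≈w : u * k ≈ w
        uk≈w = trans uk≡w (sym (m<n⇒m%n≡m w<p))
    in  k , k<p , *-cancelˡ-≈ (*-nonzero u≢0 u≢0) (begin
          ((u * u) * (k * k)) % p   ≡⟨ cong (_% p) (interchange u k) ⟩
          ((u * k) * (u * k)) % p   ≡⟨ *-cong-≈ uk≈w uk≈w ⟩
          (w * w) % p               ≡⟨ w²≈u²y ⟩
          ((u * u) * y) % p         ∎)
    where
    open ≡-Reasoning
    interchange : ∀ u k → (u * u) * (k * k) ≡ (u * k) * (u * k)
    interchange = solve-∀

  χ-*-comm : ∀ x y → χ (x * y) ≡ χ (y * x)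
  χ-*-comm x y = cong χ (ℕₚ.*-comm x y)

  χ-*-residue-residue : ∀ {x y} u v → x % p ≢ 0 → y % p ≢ 0 → u * u ≈ x → v * v ≈ y → χ (x * y) ≡ 1ℤ
  χ-*-residue-residue {x} {y} u v x≢0 y≢0 u²≈x v²≈y =
    χ-square (*-nonzero x≢0 y≢0) (m%n<n (u * v) p) (begin
      ((u * v) % p * ((u * v) % p)) % p   ≡⟨ *-cong-≈ (%-≈ (u * v)) (%-≈ (u * v)) ⟩
      ((u * v) * (u * v)) % p             ≡⟨ cong (_% p) (interchange u v) ⟩
      ((u * u) * (v * v)) % p             ≡⟨ *-cong-≈ u²≈x v²≈y ⟩
      (x * y) % p                         ∎)
    where
    open ≡-Reasoning
    interchange : ∀ u v → (u * v) * (u * v) ≡ (u * u) * (v * v)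
    interchange = solve-∀

  χ-*-residue-nonresidue : ∀ {x y} u → x % p ≢ 0 → y % p ≢ 0 → u * u ≈ x → (∀ {w} → w < p → w * w ≉ y) →
                           χ (x * y) ≡ -1ℤ
  χ-*-residue-nonresidue {x} {y} u x≢0 y≢0 u²≈x y-nonsquare with residuosity (x * y)
  ... | divisible xy≡0 _             = ⊥-elim (*-nonzero x≢0 y≢0 xy≡0)
  ... | nonresidue _ χxy≡-1 _        = χxy≡-1
  ... | residue _ _ w w<p w²≈xy      =
    let k , k<p , k²≈y = square-*-cancelˡ u (root-nonzero u u²≈x x≢0) w<p
                           (trans w²≈xy (*-cong-≈ {x} {u * u} {y} {y} (sym u²≈x) refl))
    in  ⊥-elim (y-nonsquare k<p k²≈y)

  -- D z = χ z + χ (x z) is ≤ 0 for every z, since x z is a nonresidue whenever z is a residue,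
  -- and its sum over z is 0; so D (y % p) = 0.
  χ-*-nonresidue-nonresidue : ∀ {x y} → x % p ≢ 0 → χ x ≡ -1ℤ → (∀ {w} → w < p → w * w ≉ x) → χ y ≡ -1ℤ →
                              χ (x * y) ≡ 1ℤ
  χ-*-nonresidue-nonresidue {x} {y} x≢0 χx≡-1 x-nonsquare χy≡-1 = +-cancelˡ -1ℤ (χ (x * y)) 1ℤ (begin
    -1ℤ ℤ.+ χ (x * y)
      ≡⟨ cong₂ ℤ._+_ (trans (sym χy≡-1) (χ-cong (sym (%-≈ y)))) (χ-cong (*-cong-≈ {x} refl (sym (%-≈ y)))) ⟩
    D (y % p)
      ≡⟨ sum-nonpos≡0⇒≡0 (upTo p) D (D≤0 ∘ ∈-upTo⁻) ∑D≡0 (∈-upTo⁺ (m%n<n y p)) ⟩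
    0ℤ ∎)
    where
    open ≡-Reasoning
    D : ℕ → ℤ
    D z = χ z ℤ.+ χ (x * z)
    ∑D≡0 : ∑ p D ≡ 0ℤ
    ∑D≡0 = trans (sum-distrib-+ (upTo p) χ (λ z → χ (x * z)))
                 (cong₂ ℤ._+_ ∑χ≡0 (∑χ-reindexed (x *_) (scaling-selfInjective x≢0)))
    D≤0 : ∀ {z} → z < p → D z ℤ.≤ 0ℤ
    D≤0 {z} _ with residuosity z
    ... | divisible z≡0 χz≡0
      rewrite χz≡0 | χ-divisible (divisible-*ʳ x z≡0) = ℤₚ.≤-refl
    ... | residue z≢0 χz≡1 u _ u²≈z
      rewrite χz≡1 | χ-*-comm x z | χ-*-residue-nonresidue u z≢0 x≢0 u²≈z x-nonsquare = ℤₚ.≤-refl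
    ... | nonresidue _ χz≡-1 _
      rewrite χz≡-1 = ℤₚ.+-monoʳ-≤ -1ℤ (χ≤1 (x * z))

  χ-homo-* : ∀ x y → χ (x * y) ≡ χ x ℤ.* χ y
  χ-homo-* x y with residuosity x | residuosity y
  ... | divisible x≡0 χx≡0 | _
    rewrite χx≡0 = χ-divisible (divisible-*ˡ y x≡0)
  ... | _ | divisible y≡0 χy≡0
    rewrite χy≡0 = trans (χ-divisible (divisible-*ʳ x y≡0)) (sym (ℤₚ.*-zeroʳ (χ x)))
  ... | residue x≢0 χx≡1 u _ u²≈x | residue y≢0 χy≡1 v _ v²≈y
    rewrite χx≡1 | χy≡1 = χ-*-residue-residue u v x≢0 y≢0 u²≈x v²≈y
  ... | residue x≢0 χx≡1 u _ u²≈x | nonresidue y≢0 χy≡-1 y-nonsquare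
    rewrite χx≡1 | χy≡-1 = χ-*-residue-nonresidue u x≢0 y≢0 u²≈x y-nonsquare
  ... | nonresidue x≢0 χx≡-1 x-nonsquare | residue y≢0 χy≡1 v _ v²≈y
    rewrite χx≡-1 | χy≡1 = trans (χ-*-comm x y) (χ-*-residue-nonresidue v y≢0 x≢0 v²≈y x-nonsquare)
  ... | nonresidue x≢0 χx≡-1 x-nonsquare | nonresidue _ χy≡-1 _
    rewrite χx≡-1 | χy≡-1 = χ-*-nonresidue-nonresidue x≢0 χx≡-1 x-nonsquare χy≡-1

  shift-selfInjective : ∀ u → SelfInjective p (λ k → (u + k) % p)
  shift-selfInjective u = record
    { bounded   = λ {k} _ → m%n<n _ p
    ; injective = λ k<p l<p u+k≈u+l → ≈⇒≡ k<p l<p (+-cancelˡ-≈ u u+k≈u+l)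
    }

  reflection-selfInjective : ∀ a → SelfInjective p (λ k → ((a + p) ∸ k) % p)
  reflection-selfInjective a = record
    { bounded   = λ {k} _ → m%n<n _ p
    ; injective = λ {k} {l} k<p l<p A-k≈A-l → sym (≈⇒≡ l<p k<p (+-cancelˡ-≈ (a + p) (begin
        (a + p + l) % p
          ≡⟨ cong (_% p) (restore k l k<p) ⟨
        ((a + p) ∸ k + (k + l)) % p
          ≡⟨ +-cong-≈ A-k≈A-l (refl {x = (k + l) % p}) ⟩
        ((a + p) ∸ l + (k + l)) % p
          ≡⟨ cong (_% p) (trans (cong ((a + p) ∸ l +_) (ℕₚ.+-comm k l)) (restore l k l<p)) ⟩
        (a + p + k) % p ∎)))
    }
    where
    open ≡-Reasoning
    restore : ∀ k l → k < p → (a + p) ∸ k + (k + l) ≡ a + p + l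
    restore k l k<p = begin
      (a + p) ∸ k + (k + l)   ≡⟨ ℕₚ.+-assoc ((a + p) ∸ k) k l ⟨
      (a + p) ∸ k + k + l     ≡⟨ cong (_+ l) (ℕₚ.m∸n+n≡m (ℕₚ.≤-trans (ℕₚ.<⇒≤ k<p) (ℕₚ.m≤n+m p a))) ⟩
      a + p + l               ∎

  correlation : ℕ → ℤ
  correlation c = ∑[ u < p ] (χ u ℤ.* χ (u + c))

  correlation-cong : ∀ {c d} → c ≈ d → correlation c ≡ correlation d
  correlation-cong c≈d = ∑-cong p (λ {u} _ → cong (χ u ℤ.*_) (χ-cong (+-cong-≈ {u} refl c≈d)))

  correlation-scale : ∀ {l} c → l % p ≢ 0 → correlation (l * c) ≡ correlation c
  correlation-scale {l} c l≢0 = begin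
    correlation (l * c)                     ≡⟨ ∑-reindex p (scaling-selfInjective l≢0) g ⟨
    ∑[ u < p ] g ((l * u) % p)              ≡⟨ ∑-cong p (λ {u} _ → scaled u) ⟩
    correlation c                           ∎
    where
    open ≡-Reasoning
    g : ℕ → ℤ
    g v = χ v ℤ.* χ (v + l * c)
    scaled : ∀ u → g ((l * u) % p) ≡ χ u ℤ.* χ (u + c)
    scaled u = begin
      χ ((l * u) % p) ℤ.* χ ((l * u) % p + l * c)
        ≡⟨ cong₂ ℤ._*_ (χ-cong (%-≈ (l * u))) (χ-cong (+-cong-≈ (%-≈ (l * u)) (refl {x = (l * c) % p}))) ⟩
      χ (l * u) ℤ.* χ (l * u + l * c)
        ≡⟨ cong (λ w → χ (l * u) ℤ.* χ w) (ℕₚ.*-distribˡ-+ l u c) ⟨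
      χ (l * u) ℤ.* χ (l * (u + c))
        ≡⟨ cong₂ ℤ._*_ (χ-homo-* l u) (χ-homo-* l (u + c)) ⟩
      (χ l ℤ.* χ u) ℤ.* (χ l ℤ.* χ (u + c))
        ≡⟨ *-interchange (χ l) (χ u) (χ l) (χ (u + c)) ⟩
      (χ l ℤ.* χ l) ℤ.* (χ u ℤ.* χ (u + c))
        ≡⟨ cong (ℤ._* (χ u ℤ.* χ (u + c))) (χ²≡1 l≢0) ⟩
      1ℤ ℤ.* (χ u ℤ.* χ (u + c))
        ≡⟨ ℤₚ.*-identityˡ _ ⟩
      χ u ℤ.* χ (u + c) ∎

  correlation-0 : correlation 0 ≡ ℤ.+ p ℤ.+ -1ℤ
  correlation-0 = begin
    ∑[ u < p ] (χ u ℤ.* χ (u + 0))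
      ≡⟨ ∑-cong p unit ⟩
    ∑[ u < p ] (1ℤ ℤ.+ 𝟙 (u ≡ᵇ 0) ℤ.* -1ℤ)
      ≡⟨ sum-distrib-+ (upTo p) (λ _ → 1ℤ) _ ⟩
    ∑[ u < p ] 1ℤ ℤ.+ ∑[ u < p ] (𝟙 (u ≡ᵇ 0) ℤ.* -1ℤ)
      ≡⟨ cong₂ ℤ._+_ (∑-const p 1ℤ) (∑-pick p (λ _ → -1ℤ) (ℕ.>-nonZero⁻¹ p)) ⟩
    ℤ.+ p ℤ.* 1ℤ ℤ.+ -1ℤ
      ≡⟨ cong (ℤ._+ -1ℤ) (ℤₚ.*-identityʳ (ℤ.+ p)) ⟩
    ℤ.+ p ℤ.+ -1ℤ ∎
    where
    open ≡-Reasoning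
    unit : ∀ {u} → u < p → χ u ℤ.* χ (u + 0) ≡ 1ℤ ℤ.+ 𝟙 (u ≡ᵇ 0) ℤ.* -1ℤ
    unit {u} u<p with u ≟ 0
    ... | yes refl rewrite χ-divisible 0%p≡0 = refl
    ... | no  u≢0  rewrite ℕₚ.+-identityʳ u | ≡ᵇ-false u≢0 =
      χ²≡1 (λ u≡0 → u≢0 (trans (sym (m<n⇒m%n≡m u<p)) u≡0))

  ∑correlation≡0 : ∑ p correlation ≡ 0ℤ
  ∑correlation≡0 = begin
    ∑[ c < p ] (∑[ u < p ] (χ u ℤ.* χ (u + c)))
      ≡⟨ sum-comm (upTo p) (upTo p) (λ c u → χ u ℤ.* χ (u + c)) ⟩
    ∑[ u < p ] (∑[ c < p ] (χ u ℤ.* χ (u + c)))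
      ≡⟨ ∑-cong p (λ {u} _ → *-distribˡ-sum (χ u) (upTo p) (λ c → χ (u + c))) ⟨
    ∑[ u < p ] (χ u ℤ.* ∑[ c < p ] χ (u + c))
      ≡⟨ ∑-cong p (λ {u} _ → cong (χ u ℤ.*_) (∑χ-reindexed (u +_) (shift-selfInjective u))) ⟩
    ∑[ u < p ] (χ u ℤ.* 0ℤ)
      ≡⟨ ∑-cong p (λ {u} _ → ℤₚ.*-zeroʳ (χ u)) ⟩
    ∑[ u < p ] 0ℤ
      ≡⟨ sum-zero (upTo p) ⟩
    0ℤ ∎
    where open ≡-Reasoning

  -- The correlation is constant on nonzero shifts and sums to 0 over all shifts.
  private
    [p-1][correlation-1+1]≡0 : (ℤ.+ p ℤ.+ -1ℤ) ℤ.* (correlation 1 ℤ.+ 1ℤ) ≡ 0ℤ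
    [p-1][correlation-1+1]≡0 = begin
      (ℤ.+ p ℤ.+ -1ℤ) ℤ.* (C ℤ.+ 1ℤ)               ≡⟨ expand (ℤ.+ p) C ⟩
      ℤ.+ p ℤ.* C ℤ.+ (ℤ.+ p ℤ.+ -1ℤ) ℤ.- C         ≡⟨ cong (ℤ._- C) (cong₂ ℤ._+_ (∑-const p C) correlation-0) ⟨
      ∑[ _ < p ] C ℤ.+ correlation 0 ℤ.- C          ≡⟨ cong (ℤ._- C) (∑-update p (ℕ.>-nonZero⁻¹ p) nonzero-shift) ⟨
      ∑ p correlation ℤ.+ C ℤ.- C                   ≡⟨ cong (λ s → s ℤ.+ C ℤ.- C) ∑correlation≡0 ⟩
      0ℤ ℤ.+ C ℤ.- C                                ≡⟨ cancel C ⟩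
      0ℤ                                            ∎
      where
      open ≡-Reasoning
      C : ℤ
      C = correlation 1
      nonzero-shift : ∀ {k} → k < p → k ≢ 0 → correlation k ≡ C
      nonzero-shift {k} k<p k≢0 =
        trans (cong correlation (sym (ℕₚ.*-identityʳ k)))
              (correlation-scale 1 (λ k≡0 → k≢0 (trans (sym (m<n⇒m%n≡m k<p)) k≡0)))
      expand : ∀ P C → (P ℤ.+ -1ℤ) ℤ.* (C ℤ.+ 1ℤ) ≡ P ℤ.* C ℤ.+ (P ℤ.+ -1ℤ) ℤ.- C
      expand = solve-∀ℤ
      cancel : ∀ C → 0ℤ ℤ.+ C ℤ.- C ≡ 0ℤ
      cancel = solve-∀ℤ

  correlation-1 : correlation 1 ≡ -1ℤ
  correlation-1 = [n-1]*[c+1]≡0⇒c≡-1 (ℕ.nonTrivial⇒n>1 p {{prime⇒nonTrivial p-prime}}) [p-1][correlation-1+1]≡0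

  correlation≡-1 : ∀ {c} → c % p ≢ 0 → correlation c ≡ -1ℤ
  correlation≡-1 {c} c≢0 = begin
    correlation c               ≡⟨ correlation-cong (sym (%-≈ c)) ⟩
    correlation (c % p)         ≡⟨ cong correlation (ℕₚ.*-identityʳ (c % p)) ⟨
    correlation (c % p * 1)     ≡⟨ correlation-scale 1 (λ c≡0 → c≢0 (trans (sym (%-≈ c)) c≡0)) ⟩
    correlation 1               ≡⟨ correlation-1 ⟩
    -1ℤ                         ∎
    where open ≡-Reasoning

  ∑χ-reflected : ∀ a → ∑[ k < p ] χ ((a + p) ∸ k) ≡ 0ℤ
  ∑χ-reflected a = ∑χ-reindexed (λ k → (a + p) ∸ k) (reflection-selfInjective a)

  -- The substitution u = b − k turns the sum into the correlation at a − b.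
  ∑χχ-reflected : ∀ {a b} → a < p → b < p → a ≢ b →
                  ∑[ k < p ] (χ ((a + p) ∸ k) ℤ.* χ ((b + p) ∸ k)) ≡ -1ℤ
  ∑χχ-reflected {a} {b} a<p b<p a≢b = begin
    ∑[ k < p ] (χ ((a + p) ∸ k) ℤ.* χ ((b + p) ∸ k))   ≡⟨ ∑-cong p reflected ⟩
    ∑[ k < p ] g (((b + p) ∸ k) % p)                   ≡⟨ ∑-reindex p (reflection-selfInjective b) g ⟩
    ∑[ u < p ] (χ (u + d) ℤ.* χ u)                     ≡⟨ ∑-cong p (λ {u} _ → ℤₚ.*-comm (χ (u + d)) (χ u)) ⟩
    correlation d                                      ≡⟨ correlation≡-1 d≢0 ⟩
    -1ℤ                                                ∎
    where
    open ≡-Reasoning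
    d : ℕ
    d = (a + p) ∸ b
    d+b≡a+p : d + b ≡ a + p
    d+b≡a+p = ℕₚ.m∸n+n≡m (ℕₚ.≤-trans (ℕₚ.<⇒≤ b<p) (ℕₚ.m≤n+m p a))
    d≢0 : d % p ≢ 0
    d≢0 d≡0 = a≢b (≈⇒≡ a<p b<p (begin
      a % p             ≡⟨ [m+n]%n≡m%n a p ⟨
      (a + p) % p       ≡⟨ cong (_% p) d+b≡a+p ⟨
      (d + b) % p       ≡⟨ +-cong-≈ {d} {0} (trans d≡0 (sym 0%p≡0)) (refl {x = b % p}) ⟩
      b % p             ∎))
    g : ℕ → ℤ
    g u = χ (u + d) ℤ.* χ u
    reflected : ∀ {k} → k < p → χ ((a + p) ∸ k) ℤ.* χ ((b + p) ∸ k) ≡ g (((b + p) ∸ k) % p)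
    reflected {k} k<p = cong₂ ℤ._*_ (χ-cong (begin
        ((a + p) ∸ k) % p                   ≡⟨ [m+n]%n≡m%n ((a + p) ∸ k) p ⟨
        ((a + p) ∸ k + p) % p               ≡⟨ cong (_% p) (reflection-shift b<p k<p) ⟨
        ((b + p) ∸ k + d) % p               ≡⟨ +-cong-≈ (%-≈ ((b + p) ∸ k)) (refl {x = d % p}) ⟨
        (((b + p) ∸ k) % p + d) % p         ∎))
      (χ-cong (sym (%-≈ ((b + p) ∸ k))))

record DistinctBelow (p a b c : ℕ) : Set where
  field
    a<p : a ℕ.< p
    b<p : b ℕ.< p
    c<p : c ℕ.< p
    a≢b : a ≢ b
    a≢c : a ≢ c
    b≢c : b ≢ c

module KernelBound (p : ℕ) .{{_ : NonZero p}} (p-prime : Prime p) (p-odd : ∀ y → y ℕ.+ y ≢ p) where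
  open import Data.Nat using (_+_; _≤_)
  open import Data.Integer using () renaming (_+_ to _+ℤ_)
  open import Data.Integer.Tactic.RingSolver using (solve-∀)
  open IntegerSum
  open LegendreSymbol p p-prime p-odd

  sum-others : ∀ (g : ℕ → ℤ) {a b c} → DistinctBelow p a b c →
               sumℤ (map g (others p a b c)) +ℤ (g a +ℤ (g b +ℤ g c)) ≡ ∑ p g
  sum-others g {a} {b} {c} abc = sym (begin
    ∑ p g
      ≡⟨ ∑-cong p (λ {k} _ → split k) ⟩
    ∑[ k < p ] (kept k +ℤ (pick a k +ℤ (pick b k +ℤ pick c k)))
      ≡⟨ sum-distrib-+ (upTo p) kept _ ⟩
    ∑ p kept +ℤ ∑[ k < p ] (pick a k +ℤ (pick b k +ℤ pick c k))
      ≡⟨ cong (∑ p kept +ℤ_) (sum-distrib-+ (upTo p) (pick a) _) ⟩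
    ∑ p kept +ℤ (∑ p (pick a) +ℤ ∑[ k < p ] (pick b k +ℤ pick c k))
      ≡⟨ cong (λ s → ∑ p kept +ℤ (∑ p (pick a) +ℤ s)) (sum-distrib-+ (upTo p) (pick b) (pick c)) ⟩
    ∑ p kept +ℤ (∑ p (pick a) +ℤ (∑ p (pick b) +ℤ ∑ p (pick c)))
      ≡⟨ cong₂ _+ℤ_ (sym (sum-filterᵇ _ (upTo p) g)) (cong₂ _+ℤ_ (∑-pick p g a<p) (cong₂ _+ℤ_ (∑-pick p g b<p) (∑-pick p g c<p))) ⟩
    sumℤ (map g (others p a b c)) +ℤ (g a +ℤ (g b +ℤ g c))
      ∎)
    where
    open ≡-Reasoning
    open DistinctBelow abc
    kept : ℕ → ℤ
    kept k = if not ((k ≡ᵇ a) ∨ (k ≡ᵇ b) ∨ (k ≡ᵇ c)) then g k else 0ℤ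
    pick : ℕ → ℕ → ℤ
    pick x k = 𝟙 (k ≡ᵇ x) ℤ.* g k
    outside : ∀ x → x ≡ x +ℤ (0ℤ ℤ.* x +ℤ (0ℤ ℤ.* x +ℤ 0ℤ ℤ.* x))
    outside = solve-∀
    at-a : ∀ x → x ≡ 0ℤ +ℤ (1ℤ ℤ.* x +ℤ (0ℤ ℤ.* x +ℤ 0ℤ ℤ.* x))
    at-a = solve-∀
    at-b : ∀ x → x ≡ 0ℤ +ℤ (0ℤ ℤ.* x +ℤ (1ℤ ℤ.* x +ℤ 0ℤ ℤ.* x))
    at-b = solve-∀
    at-c : ∀ x → x ≡ 0ℤ +ℤ (0ℤ ℤ.* x +ℤ (0ℤ ℤ.* x +ℤ 1ℤ ℤ.* x))
    at-c = solve-∀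
    split : ∀ k → g k ≡ kept k +ℤ (pick a k +ℤ (pick b k +ℤ pick c k))
    split k with k ≡ᵇ a | ≡ᵇ-reflects-≡ k a | k ≡ᵇ b | ≡ᵇ-reflects-≡ k b | k ≡ᵇ c | ≡ᵇ-reflects-≡ k c
    ... | true  | ofʸ refl | true  | ofʸ refl | _     | _        = ⊥-elim (a≢b refl)
    ... | true  | ofʸ refl | false | _        | true  | ofʸ refl = ⊥-elim (a≢c refl)
    ... | false | _        | true  | ofʸ refl | true  | ofʸ refl = ⊥-elim (b≢c refl)
    ... | true  | _        | false | _        | false | _        = at-a (g k)
    ... | false | _        | true  | _        | false | _        = at-b (g k)
    ... | false | _        | false | _        | true  | _        = at-c (g k)
    ... | false | _        | false | _        | false | _        = outside (g k)

  ∣sum-others∣≤4 : ∀ (g : ℕ → ℤ) {a b c} → DistinctBelow p a b c → (∀ k → ℤ.∣ g k ∣ ≤ 1) → ℤ.∣ ∑ p g ∣ ≤ 1 →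
                   ℤ.∣ sumℤ (map g (others p a b c)) ∣ ≤ 4
  ∣sum-others∣≤4 g {a} {b} {c} abc ∣g∣≤1 ∣∑g∣≤1 = begin
    ℤ.∣ O ∣
      ≡⟨ cong ℤ.∣_∣ (trans (split O Y) (cong (ℤ._- Y) (sum-others g abc))) ⟩
    ℤ.∣ ∑ p g ℤ.- Y ∣
      ≤⟨ ℤₚ.∣i-j∣≤∣i∣+∣j∣ (∑ p g) Y ⟩
    ℤ.∣ ∑ p g ∣ + ℤ.∣ g a +ℤ (g b +ℤ g c) ∣
      ≤⟨ ℕₚ.+-monoʳ-≤ ℤ.∣ ∑ p g ∣ (ℤₚ.∣i+j∣≤∣i∣+∣j∣ (g a) (g b +ℤ g c)) ⟩
    ℤ.∣ ∑ p g ∣ + (ℤ.∣ g a ∣ + ℤ.∣ g b +ℤ g c ∣)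
      ≤⟨ ℕₚ.+-monoʳ-≤ ℤ.∣ ∑ p g ∣ (ℕₚ.+-monoʳ-≤ ℤ.∣ g a ∣ (ℤₚ.∣i+j∣≤∣i∣+∣j∣ (g b) (g c))) ⟩
    ℤ.∣ ∑ p g ∣ + (ℤ.∣ g a ∣ + (ℤ.∣ g b ∣ + ℤ.∣ g c ∣))
      ≤⟨ ℕₚ.+-mono-≤ ∣∑g∣≤1 (ℕₚ.+-mono-≤ (∣g∣≤1 a) (ℕₚ.+-mono-≤ (∣g∣≤1 b) (∣g∣≤1 c))) ⟩
    4 ∎
    where
    open ℕₚ.≤-Reasoning
    O Y : ℤ
    O = sumℤ (map g (others p a b c))
    Y = g a +ℤ (g b +ℤ g c)
    split : ∀ O Y → O ≡ (O +ℤ Y) ℤ.- Y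
    split = solve-∀

  ∣0∣≤1 : ∀ {x} → x ≡ 0ℤ → ℤ.∣ x ∣ ≤ 1
  ∣0∣≤1 refl = ℕ.z≤n

  ∣-1∣≤1 : ∀ {x} → x ≡ -1ℤ → ℤ.∣ x ∣ ≤ 1
  ∣-1∣≤1 refl = ℕₚ.≤-refl

  ∣χ*χ∣≤1 : ∀ x y → ℤ.∣ χ x ℤ.* χ y ∣ ≤ 1
  ∣χ*χ∣≤1 x y = ℕₚ.≤-trans (ℕₚ.≤-reflexive (ℤₚ.∣i*j∣≡∣i∣*∣j∣ (χ x) (χ y))) (ℕₚ.*-mono-≤ (∣χ∣≤1 x) (∣χ∣≤1 y))

  ∣kernel∣≤4 : ∀ i j {a b c} → DistinctBelow p a b c → ℤ.∣ kernel p i j a b c ∣ ≤ 4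
  ∣kernel∣≤4 i1 j1 {a}         abc = ∣sum-others∣≤4 (S p a) abc (λ _ → ∣χ∣≤1 _) (∣0∣≤1 (∑χ-reflected a))
  ∣kernel∣≤4 i1 j2 {b = b}     abc = ∣sum-others∣≤4 (S p b) abc (λ _ → ∣χ∣≤1 _) (∣0∣≤1 (∑χ-reflected b))
  ∣kernel∣≤4 i1 j3 {c = c}     abc = ∣sum-others∣≤4 (S p c) abc (λ _ → ∣χ∣≤1 _) (∣0∣≤1 (∑χ-reflected c))
  ∣kernel∣≤4 i2 j1             abc = ∣sum-others∣≤4 _ abc (λ _ → ∣χ*χ∣≤1 _ _) (∣-1∣≤1 (∑χχ-reflected a<p b<p a≢b))
    where open DistinctBelow abc
  ∣kernel∣≤4 i2 j2             abc = ∣sum-others∣≤4 _ abc (λ _ → ∣χ*χ∣≤1 _ _) (∣-1∣≤1 (∑χχ-reflected a<p c<p a≢c))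
    where open DistinctBelow abc
  ∣kernel∣≤4 i2 j3             abc = ∣sum-others∣≤4 _ abc (λ _ → ∣χ*χ∣≤1 _ _) (∣-1∣≤1 (∑χχ-reflected b<p c<p b≢c))
    where open DistinctBelow abc

module EntryBound (p : ℕ) .{{_ : NonZero p}} (p-prime : Prime p) (p-odd : ∀ y → y ℕ.+ y ≢ p) where
  open import Data.Nat using (_+_; _*_; _<_)
  open import Data.Nat.Tactic.RingSolver using (solve-∀)
  open import Algebra.Properties.CommutativeSemigroup ℤₚ.+-commutativeSemigroup using () renaming (interchange to +-interchange)
  open import Data.Integer using (+_; _≤_) renaming (_+_ to _+ℤ_; _*_ to _*ℤ_)
  open IntegerSum
  open KernelBound p p-prime p-odd

  pairs-member : ∀ {e} → e ∈ pairs p → proj₁ e < proj₂ e × proj₂ e < p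
  pairs-member e∈ with find (∈-concatMap⁻ (λ a → map (a ,_) (filterᵇ (a <ᵇ_) (upTo p))) {xs = upTo p} e∈)
  ... | a , _ , e∈a with ∈-map⁻ (a ,_) e∈a
  ...   | b , b∈ , refl with ∈-filter⁻ (T? ∘ (a <ᵇ_)) b∈
  ...     | b∈upTo , a<ᵇb = ℕₚ.<ᵇ⇒< a b a<ᵇb , ∈-upTo⁻ b∈upTo

  hits : ℕ → ℕ × ℕ → ℤ
  hits c (f₁ , f₂) = 𝟙 (c ≡ᵇ f₁) +ℤ 𝟙 (c ≡ᵇ f₂)

  incidences : ℕ × ℕ → ℕ × ℕ → ℤ
  incidences (e₁ , e₂) f = hits e₁ f +ℤ hits e₂ f

  ≤4*suc : ∀ {m n} → m ℕ.≤ 4 → m ℕ.≤ 4 * suc n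
  ≤4*suc {n = n} m≤4 = ℕₚ.≤-trans m≤4 (ℕₚ.m≤m*n 4 (suc n))

  ∣U∣≤4*incidences : ∀ i j {e f} → e ∈ pairs p → f ∈ pairs p → + ℤ.∣ U p i j e f ∣ ≤ + 4 *ℤ incidences e f
  ∣U∣≤4*incidences i j {e₁ , e₂} {f₁ , f₂} e∈ f∈
    with e₁<e₂ , e₂<p ← pairs-member e∈ | f₁<f₂ , f₂<p ← pairs-member f∈
    with e₁ ≡ᵇ f₁ | ≡ᵇ-reflects-≡ e₁ f₁ | e₂ ≡ᵇ f₂ | ≡ᵇ-reflects-≡ e₂ f₂
       | e₁ ≡ᵇ f₂ | ≡ᵇ-reflects-≡ e₁ f₂ | e₂ ≡ᵇ f₁ | ≡ᵇ-reflects-≡ e₂ f₁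
  ... | true  | _        | true  | _        | _     | _        | _     | _        = ℤ.+≤+ ℕ.z≤n
  ... | true  | ofʸ refl | false | ofⁿ e₂≢f₂ | _     | _        | _     | _        =
    ℤ.+≤+ (≤4*suc (∣kernel∣≤4 i j (record
      { a<p = e₁<p ; b<p = e₂<p ; c<p = f₂<p
      ; a≢b = ℕₚ.<⇒≢ e₁<e₂ ; a≢c = ℕₚ.<⇒≢ f₁<f₂ ; b≢c = e₂≢f₂ })))
    where
    e₁<p : e₁ ℕ.< p
    e₁<p = ℕₚ.<-trans e₁<e₂ e₂<p
  ... | false | ofⁿ e₁≢f₁ | _     | _        | true  | ofʸ refl | _     | _        =
    ℤ.+≤+ (≤4*suc (∣kernel∣≤4 i j (record
      { a<p = f₂<p ; b<p = e₂<p ; c<p = ℕₚ.<-trans f₁<f₂ f₂<p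
      ; a≢b = ℕₚ.<⇒≢ e₁<e₂ ; a≢c = e₁≢f₁ ; b≢c = ℕₚ.<⇒≢ (ℕₚ.<-trans f₁<f₂ e₁<e₂) ∘ sym })))
  ... | false | _        | _     | _        | false | ofⁿ e₁≢f₂ | true  | ofʸ refl =
    ℤ.+≤+ (≤4*suc (∣kernel∣≤4 i j (record
      { a<p = e₂<p ; b<p = ℕₚ.<-trans e₁<e₂ e₂<p ; c<p = f₂<p
      ; a≢b = ℕₚ.<⇒≢ e₁<e₂ ∘ sym ; a≢c = ℕₚ.<⇒≢ f₁<f₂ ; b≢c = e₁≢f₂ })))
  ... | false | ofⁿ e₁≢f₁ | true  | ofʸ refl | false | _        | false | ofⁿ e₂≢f₁ =
    ℤ.+≤+ (≤4*suc {n = 0} (∣kernel∣≤4 i j (record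
      { a<p = e₂<p ; b<p = ℕₚ.<-trans e₁<e₂ e₂<p ; c<p = ℕₚ.<-trans f₁<f₂ f₂<p
      ; a≢b = ℕₚ.<⇒≢ e₁<e₂ ∘ sym ; a≢c = e₂≢f₁ ; b≢c = e₁≢f₁ })))
  ... | false | _        | false | _        | false | _        | false | _        = ℤ.+≤+ ℕ.z≤n

  sum-pairs : ∀ (F : ℕ × ℕ → ℤ) →
              sumℤ (map F (pairs p)) ≡ ∑[ a < p ] (∑[ b < p ] (if a <ᵇ b then F (a , b) else 0ℤ))
  sum-pairs F = trans (sum-concatMap G (upTo p) F) (sum-cong (upTo p) (λ {a} _ → row a))
    where
    G : ℕ → List (ℕ × ℕ)
    G a = map (a ,_) (filterᵇ (a <ᵇ_) (upTo p))
    row : ∀ a → sumℤ (map F (G a)) ≡ ∑[ b < p ] (if a <ᵇ b then F (a , b) else 0ℤ)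
    row a = trans (cong sum (sym (map-∘ (filterᵇ (a <ᵇ_) (upTo p)))))
                  (sum-filterᵇ (a <ᵇ_) (upTo p) (λ b → F (a , b)))

  sum-hits≤2p : ∀ c → sumℤ (map (hits c) (pairs p)) ≤ + p +ℤ + p
  sum-hits≤2p c = begin
    sumℤ (map (hits c) (pairs p))
      ≡⟨ sum-pairs (hits c) ⟩
    ∑[ a < p ] (∑[ b < p ] (if a <ᵇ b then hits c (a , b) else 0ℤ))
      ≤⟨ sum-mono-≤ (upTo p) (λ {a} _ → sum-mono-≤ (upTo p) (λ {b} _ → unordered a b)) ⟩
    ∑[ a < p ] (∑[ b < p ] (𝟙 (c ≡ᵇ a) +ℤ 𝟙 (c ≡ᵇ b)))
      ≡⟨ ∑-cong p (λ {a} _ → sum-distrib-+ (upTo p) (λ _ → 𝟙 (c ≡ᵇ a)) (λ b → 𝟙 (c ≡ᵇ b))) ⟩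
    ∑[ a < p ] (∑[ b < p ] 𝟙 (c ≡ᵇ a) +ℤ K)
      ≡⟨ sum-distrib-+ (upTo p) _ (λ _ → K) ⟩
    ∑[ a < p ] (∑[ b < p ] 𝟙 (c ≡ᵇ a)) +ℤ ∑[ a < p ] K
      ≡⟨ cong₂ _+ℤ_ (∑-cong p (λ {a} _ → ∑-const p (𝟙 (c ≡ᵇ a)))) (∑-const p K) ⟩
    ∑[ a < p ] (+ p *ℤ 𝟙 (c ≡ᵇ a)) +ℤ + p *ℤ K
      ≡⟨ cong (_+ℤ + p *ℤ K) (*-distribˡ-sum (+ p) (upTo p) (λ a → 𝟙 (c ≡ᵇ a))) ⟨
    + p *ℤ K +ℤ + p *ℤ K
      ≤⟨ ℤₚ.+-mono-≤ p*K≤p p*K≤p ⟩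
    + p +ℤ + p
      ∎
    where
    open ℤₚ.≤-Reasoning
    K : ℤ
    K = ∑[ b < p ] 𝟙 (c ≡ᵇ b)
    unordered : ∀ a b → (if a <ᵇ b then hits c (a , b) else 0ℤ) ≤ 𝟙 (c ≡ᵇ a) +ℤ 𝟙 (c ≡ᵇ b)
    unordered a b with a <ᵇ b
    ... | true  = ℤₚ.≤-refl
    ... | false = ℤ.+≤+ ℕ.z≤n
    K≤1 : K ≤ 1ℤ
    K≤1 rewrite ∑-cong p (λ {b} _ → cong 𝟙 (≡ᵇ-sym c b)) | ∑-indicator p c with c <ᵇ p
    ... | true  = ℤₚ.≤-refl
    ... | false = ℤ.+≤+ ℕ.z≤n
    p*K≤p : + p *ℤ K ≤ + p
    p*K≤p = ℤₚ.≤-trans (ℤₚ.*-monoˡ-≤-nonNeg (+ p) K≤1) (ℤₚ.≤-reflexive (ℤₚ.*-identityʳ (+ p)))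

  sum-4*incidences≤16p : ∀ (F : ℕ × ℕ → ℤ) c₁ c₂ → (∀ x → F x ≡ hits c₁ x +ℤ hits c₂ x) →
                         sumℤ (map (λ x → + 4 *ℤ F x) (pairs p)) ≤ + (16 * p)
  sum-4*incidences≤16p F c₁ c₂ F≡hits = begin
    sumℤ (map (λ x → + 4 *ℤ F x) (pairs p))
      ≡⟨ *-distribˡ-sum (+ 4) (pairs p) F ⟨
    + 4 *ℤ sumℤ (map F (pairs p))
      ≡⟨ cong (+ 4 *ℤ_) (trans (sum-cong (pairs p) (λ {x} _ → F≡hits x)) (sum-distrib-+ (pairs p) (hits c₁) (hits c₂))) ⟩
    + 4 *ℤ (sumℤ (map (hits c₁) (pairs p)) +ℤ sumℤ (map (hits c₂) (pairs p)))
      ≤⟨ ℤₚ.*-monoˡ-≤-nonNeg (+ 4) (ℤₚ.+-mono-≤ (sum-hits≤2p c₁) (sum-hits≤2p c₂)) ⟩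
    + 4 *ℤ + ((p + p) + (p + p))
      ≡⟨ ℤₚ.pos-* 4 ((p + p) + (p + p)) ⟨
    + (4 * ((p + p) + (p + p)))
      ≡⟨ cong +_ (sixteen p) ⟩
    + (16 * p)
      ∎
    where
    open ℤₚ.≤-Reasoning
    sixteen : ∀ p → 4 * ((p + p) + (p + p)) ≡ 16 * p
    sixteen = solve-∀

  row-sum≤16p : ∀ i j {e} → e ∈ pairs p → sumℤ (map (λ f → + ℤ.∣ U p i j e f ∣) (pairs p)) ≤ + (16 * p)
  row-sum≤16p i j {e} e∈ =
    ℤₚ.≤-trans (sum-mono-≤ (pairs p) (∣U∣≤4*incidences i j e∈))
               (sum-4*incidences≤16p (incidences e) (proj₁ e) (proj₂ e) (λ _ → refl))

  column-sum≤16p : ∀ i j {f} → f ∈ pairs p → sumℤ (map (λ e → + ℤ.∣ U p i j e f ∣) (pairs p)) ≤ + (16 * p)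
  column-sum≤16p i j {f} f∈ =
    ℤₚ.≤-trans (sum-mono-≤ (pairs p) (λ e∈ → ∣U∣≤4*incidences i j e∈ f∈))
               (sum-4*incidences≤16p (λ e → incidences e f) (proj₁ f) (proj₂ f) transposed)
    where
    transposed : ∀ e → incidences e f ≡ hits (proj₁ f) e +ℤ hits (proj₂ f) e
    transposed (e₁ , e₂) = begin
      (𝟙 (e₁ ≡ᵇ f₁) +ℤ 𝟙 (e₁ ≡ᵇ f₂)) +ℤ (𝟙 (e₂ ≡ᵇ f₁) +ℤ 𝟙 (e₂ ≡ᵇ f₂))
        ≡⟨ +-interchange (𝟙 (e₁ ≡ᵇ f₁)) (𝟙 (e₁ ≡ᵇ f₂)) (𝟙 (e₂ ≡ᵇ f₁)) (𝟙 (e₂ ≡ᵇ f₂)) ⟩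
      (𝟙 (e₁ ≡ᵇ f₁) +ℤ 𝟙 (e₂ ≡ᵇ f₁)) +ℤ (𝟙 (e₁ ≡ᵇ f₂) +ℤ 𝟙 (e₂ ≡ᵇ f₂))
        ≡⟨ cong₂ _+ℤ_ (cong₂ _+ℤ_ (flip e₁ f₁) (flip e₂ f₁)) (cong₂ _+ℤ_ (flip e₁ f₂) (flip e₂ f₂)) ⟩
      (𝟙 (f₁ ≡ᵇ e₁) +ℤ 𝟙 (f₁ ≡ᵇ e₂)) +ℤ (𝟙 (f₂ ≡ᵇ e₁) +ℤ 𝟙 (f₂ ≡ᵇ e₂))
        ∎
      where
      open ≡-Reasoning
      f₁ f₂ : ℕ
      f₁ = proj₁ f
      f₂ = proj₂ f
      flip : ∀ m n → 𝟙 (m ≡ᵇ n) ≡ 𝟙 (n ≡ᵇ m)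
      flip m n = cong 𝟙 (≡ᵇ-sym m n)

≡1-mod-4⇒odd : ∀ {p} → p % 4 ≡ 1 → ∀ y → y ℕ.+ y ≢ p
≡1-mod-4⇒odd {p} p≡1 y refl = 0≢1 (begin
  0                       ≡⟨ m*n%n≡0 y 2 ⟨
  (y ℕ.* 2) % 2           ≡⟨ cong (_% 2) (ℕₚ.*-comm y 2) ⟩
  (y ℕ.+ (y ℕ.+ 0)) % 2   ≡⟨ cong (λ z → (y ℕ.+ z) % 2) (ℕₚ.+-identityʳ y) ⟩
  (y ℕ.+ y) % 2           ≡⟨ m∣n⇒o%n%m≡o%m 2 4 (y ℕ.+ y) (divides 2 refl) ⟨
  (y ℕ.+ y) % 4 % 2       ≡⟨ cong (_% 2) p≡1 ⟩
  1                       ∎)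
  where
  open ≡-Reasoning
  0≢1 : 0 ≢ 1
  0≢1 ()

OpNormBound-16p : ∀ i j p .{{_ : NonZero p}} → Prime p → p % 4 ≡ 1 → OpNormBound p i j (16 ℕ.* p)
OpNormBound-16p i j p p-prime p≡1 =
  schur-test-ℤ (pairs p) (U p i j) (16 ℕ.* p) (row-sum≤16p i j) (column-sum≤16p i j)
  where
  open SchurTest using (schur-test-ℤ)
  open EntryBound p p-prime (≡1-mod-4⇒odd p≡1) using (row-sum≤16p; column-sum≤16p)

open import Data.Nat using (_*_; _≤_)

proposition3p29 : (i : I) → (j : J) →
    Σ ℕ (λ C → Σ ℕ (λ N → (p : ℕ) → .{{_ : NonZero p}} → Prime p → p % 4 ≡ 1 → N ≤ p →
      OpNormBound p i j (C * p)))
proposition3p29 i j = 16 , 0 , λ p p-prime p≡1 _ → OpNormBound-16p i j p p-prime p≡1
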